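{- Up to equivalence and relabellings of diagrams, the following are in bijective correspondence: (i) an open DAG $(G,I,O)$ over vertices $V$; (ii) a network diagram with wire labels $V$, inputs $I$ and outputs $O$. The correspondence sends $(G,I,O)$ to the diagram $D_{(G,I,O)}$ and a network diagram $D$ to the open DAG $(G_D,I_D,O_D)$, and these assignments are mutually inverse.
   Context: An open DAG $(G,I,O)$ is a finite DAG $G$ with vertex set $V$ together with subsets $O\subseteq V$ (outputs) and $I\subseteq V$ (inputs) such that every vertex in $I$ has no parents in $G$ ($I$ and $O$ need not be disjoint). A network diagram is a string diagram (in the free cd-category, with commutative comonoid copy maps and discard maps on each wire type) built from boxes with exactly one output wire, copy maps and discarding effects, with wire labels such that wires not connected by a sequence of copy maps carry distinct labels, each label appears as an output of the diagram at most once and as an input to any given box at most once. Two network diagrams are equivalent if equal by the cd-category axioms, up to relabelling of wires and boxes. $D_{(G,I,O)}$: for each vertex $X\notin I$ with parents $Y_1,\dots,Y_m$ draw a box $c_X$ with inputs $Y_1,\dots,Y_m$ and output $X$; each input vertex $i\in I$ is instead an input wire of the diagram. The wire of each vertex $X$ is copied $k+1$ times if $X\in O$ and $k$ times otherwise ($k$ = number of children; $0$ copies = discard), one copy being plugged into $c_Z$ for each edge $X\to Z$, the remaining copy being a diagram output if $X\in O$. $(G_D,I_D,O_D)$: vertices are the outputs of non-copy boxes of $D$ together with the input wires of $D$; edges $X\to Y$ whenever $X$ is an input of the box with output $Y$; $I_D$ the input wires of $D$, $O_D$ the output labels of $D$. -}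

module Defs where

open import Data.Nat using (ℕ; zero; suc; _+_)
open import Data.Bool using (Bool; true; false; if_then_else_; not; _∧_)
open import Data.Fin using (Fin; zero; suc)
open import Data.Fin.Properties using (_≟_)
open import Data.Fin.Subset using (Subset; ⊥; _∈_; _∪_)
open import Data.List using (List; []; _∷_; _++_; [_]; map; filterᵇ; allFin)
open import Data.Bool.ListAction using (all; any)
open import Data.List.Properties using (++-assoc)
open import Data.Maybe using (Maybe; just; nothing)
open import Data.Vec using (Vec; lookup; replicate) renaming ([] to []ᵥ; _∷_ to _∷ᵥ_)
open import Relation.Nullary using (¬_; yes; no; does)
open import Relation.Binary.PropositionalEquality using (_≡_; refl; subst; sym; cong)

variable
  n : ℕ

elems : Subset n → List (Fin n)
elems {zero}  []ᵥ           = []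
elems {suc n} (true  ∷ᵥ p)  = zero ∷ map suc (elems p)
elems {suc n} (false ∷ᵥ p)  = map suc (elems p)

elems-⊥ : ∀ n → elems {n} ⊥ ≡ []
elems-⊥ zero    = refl
elems-⊥ (suc n) = cong (map suc) (elems-⊥ n)

-- Open DAGs (G, I, O) over V = Fin n.
-- The edge relation is given by the parent sets: X → Y iff X ∈ par Y.

data Path (par : Fin n → Subset n) : Fin n → Fin n → Set where
  edge : ∀ {x y}   → x ∈ par y → Path par x y
  _◂_  : ∀ {x y z} → x ∈ par y → Path par y z → Path par x z

record IsOpenDAG (par : Fin n → Subset n) (I : Subset n) : Set where
  field
    acyclic     : ∀ x → ¬ Path par x x
    inputs-root : ∀ i → i ∈ I → par i ≡ ⊥

-- Terms of the free cd-category over the signature whose wire types are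
-- the labels Fin n and whose boxes are  box P x : (elements of P) → x
-- (objects are lists of labels, strict monoidal product is _++_).

data Tm {n : ℕ} : List (Fin n) → List (Fin n) → Set where
  id  : ∀ a → Tm a a
  _⨾_ : ∀ {a b c} → Tm a b → Tm b c → Tm a c
  _⊗_ : ∀ {a b c d} → Tm a b → Tm c d → Tm (a ++ c) (b ++ d)
  σ   : ∀ a b → Tm (a ++ b) (b ++ a)
  δ   : ∀ x → Tm [ x ] (x ∷ x ∷ [])
  ε   : ∀ x → Tm [ x ] []
  box : (P : Subset n) (x : Fin n) → Tm (elems P) [ x ]

infixr 9 _⨾_
infixr 10 _⊗_

cast : ∀ {a b : List (Fin n)} → a ≡ b → Tm a b
cast {a = a} p = subst (Tm a) p (id a)

-- Equality by the cd-category axioms (heterogeneous in the boundary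
-- types, since strict associativity/unitality of _++_ only holds
-- propositionally; every constructor relates terms whose boundaries agree).

infix 4 _≈_
data _≈_ {n : ℕ} : ∀ {a b c d : List (Fin n)} → Tm a b → Tm c d → Set where
  ≈-refl  : ∀ {a b} {f : Tm a b} → f ≈ f
  ≈-sym   : ∀ {a b c d} {f : Tm a b} {g : Tm c d} → f ≈ g → g ≈ f
  ≈-trans : ∀ {a b c d e h} {f : Tm a b} {g : Tm c d} {k : Tm e h} →
            f ≈ g → g ≈ k → f ≈ k
  ⨾-cong  : ∀ {a b c} {f f' : Tm a b} {g g' : Tm b c} →
            f ≈ f' → g ≈ g' → (f ⨾ g) ≈ (f' ⨾ g')
  ⊗-cong  : ∀ {a b c d} {f f' : Tm a b} {g g' : Tm c d} →
            f ≈ f' → g ≈ g' → (f ⊗ g) ≈ (f' ⊗ g')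
  cast-id : ∀ {a b} (p : a ≡ b) → cast p ≈ id b
  idˡ     : ∀ {a b} (f : Tm a b) → (id a ⨾ f) ≈ f
  idʳ     : ∀ {a b} (f : Tm a b) → (f ⨾ id b) ≈ f
  ⨾-assoc : ∀ {a b c d} (f : Tm a b) (g : Tm b c) (h : Tm c d) →
            ((f ⨾ g) ⨾ h) ≈ (f ⨾ (g ⨾ h))
  ⊗-assoc : ∀ {a b c d e h} (f : Tm a b) (g : Tm c d) (k : Tm e h) →
            ((f ⊗ g) ⊗ k) ≈ (f ⊗ (g ⊗ k))
  ⊗-unitˡ : ∀ {a b} (f : Tm a b) → (id [] ⊗ f) ≈ f
  ⊗-unitʳ : ∀ {a b} (f : Tm a b) → (f ⊗ id []) ≈ f
  ⊗-id    : ∀ a b → (id a ⊗ id b) ≈ id (a ++ b)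
  interchange : ∀ {a b c d e h} (f : Tm a b) (g : Tm c d) (f' : Tm b e) (g' : Tm d h) →
            ((f ⊗ g) ⨾ (f' ⊗ g')) ≈ ((f ⨾ f') ⊗ (g ⨾ g'))
  σ-natural : ∀ {a b c d} (f : Tm a b) (g : Tm c d) →
            ((f ⊗ g) ⨾ σ b d) ≈ (σ a c ⨾ (g ⊗ f))
  σ-inv   : ∀ a b → (σ a b ⨾ σ b a) ≈ id (a ++ b)
  σ-unitˡ : ∀ a → σ [] a ≈ id a
  σ-unitʳ : ∀ a → σ a [] ≈ id a
  σ-hexˡ  : ∀ a b c →
            σ a (b ++ c) ≈ ((σ a b ⊗ id c) ⨾ cast (++-assoc b a c) ⨾ (id b ⊗ σ a c))
  σ-hexʳ  : ∀ a b c →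
            σ (a ++ b) c ≈ (cast (++-assoc a b c) ⨾ (id a ⊗ σ b c) ⨾
                            cast (sym (++-assoc a c b)) ⨾ (σ a c ⊗ id b))
  δ-assoc : ∀ x → (δ x ⨾ (δ x ⊗ id [ x ])) ≈ (δ x ⨾ (id [ x ] ⊗ δ x))
  δ-unitˡ : ∀ x → (δ x ⨾ (ε x ⊗ id [ x ])) ≈ id [ x ]
  δ-unitʳ : ∀ x → (δ x ⨾ (id [ x ] ⊗ ε x)) ≈ id [ x ]
  δ-comm  : ∀ x → (δ x ⨾ σ [ x ] [ x ]) ≈ δ x

boxCount : ∀ {a b : List (Fin n)} → Tm a b → Fin n → ℕ
boxCount (id _)    x = 0
boxCount (f ⨾ g)   x = boxCount f x + boxCount g x
boxCount (f ⊗ g)   x = boxCount f x + boxCount g x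
boxCount (σ _ _)   x = 0
boxCount (δ _)     x = 0
boxCount (ε _)     x = 0
boxCount (box P y) x = if does (y ≟ x) then 1 else 0

inputCount : Subset n → Fin n → ℕ
inputCount I x = if lookup I x then 1 else 0

-- A network diagram with wire labels V = Fin n, inputs I and outputs O:
-- a term  D : elems I → elems O  in which every label is the label of
-- exactly one wire source (a diagram input or a box output).
IsNetwork : ∀ {O : Subset n} (I : Subset n) → Tm (elems I) (elems O) → Set
IsNetwork I D = ∀ x → boxCount D x + inputCount I x ≡ 1

-- G_D: X → Y iff X is an input of the box with output Y
parD : ∀ {a b : List (Fin n)} → Tm a b → Fin n → Subset n
parD (id _)    y = ⊥
parD (f ⨾ g)   y = parD f y ∪ parD g y
parD (f ⊗ g)   y = parD f y ∪ parD g y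
parD (σ _ _)   y = ⊥
parD (δ _)     y = ⊥
parD (ε _)     y = ⊥
parD (box P x) y = if does (x ≟ y) then P else ⊥

δs : (a : List (Fin n)) → Tm a (a ++ a)
δs []      = id []
δs (x ∷ a) = (δ x ⊗ δs a) ⨾ (id [ x ] ⊗ ((σ [ x ] a ⊗ id a) ⨾ cast (++-assoc a [ x ] a)))

εs : (a : List (Fin n)) → Tm a []
εs []      = id []
εs (x ∷ a) = ε x ⊗ εs a

-- keep (the first) wire labelled y, discard the others
-- (if y does not occur, a dummy input-less box is used; this never
--  happens in the construction for an open DAG)
proj : (y : Fin n) (a : List (Fin n)) → Tm a [ y ]
proj {n} y [] = cast (sym (elems-⊥ n)) ⨾ box ⊥ y
proj y (x ∷ a) with x ≟ y
... | yes refl = id [ x ] ⊗ εs a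
... | no  _    = ε x ⊗ proj y a

sel : (a b : List (Fin n)) → Tm a b
sel a []      = εs a
sel a (y ∷ b) = δs a ⨾ (proj y a ⊗ sel a b)

step : (cur : List (Fin n)) (v : Fin n) (P : Subset n) → Tm cur (cur ++ [ v ])
step cur v P = δs cur ⨾ (id cur ⊗ (sel cur (elems P) ⨾ box P v))

after : List (Fin n) → List (Fin n) → List (Fin n)
after cur []       = cur
after cur (v ∷ vs) = after (cur ++ [ v ]) vs

build : (par : Fin n → Subset n) (cur vs : List (Fin n)) → Tm cur (after cur vs)
build par cur []       = id cur
build par cur (v ∷ vs) = step cur v (par v) ⨾ build par (cur ++ [ v ]) vs

memb : Fin n → List (Fin n) → Bool
memb v = any (λ z → does (z ≟ v))

ready : (Fin n → Subset n) → List (Fin n) → Fin n → Bool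
ready par placed v = not (memb v placed) ∧ all (λ p → memb p placed) (elems (par v))

firstReady : (Fin n → Subset n) → List (Fin n) → Maybe (Fin n)
firstReady {n} par placed with filterᵇ (ready par placed) (allFin n)
... | []    = nothing
... | v ∷ _ = just v

topoFrom : (Fin n → Subset n) → ℕ → List (Fin n) → List (Fin n)
topoFrom par zero    placed = []
topoFrom par (suc k) placed with firstReady par placed
... | nothing = []
... | just v  = v ∷ topoFrom par k (placed ++ [ v ])

topo : (Fin n → Subset n) → Subset n → List (Fin n)
topo {n} par I = topoFrom par n (elems I)

DG : (par : Fin n → Subset n) (I O : Subset n) → Tm (elems I) (elems O)
DG par I O = build par (elems I) (topo par I) ⨾ sel (after (elems I) (topo par I)) (elems O)

{-# OPTIONS --safe #-}
-- Every term of the free cd-category rewrites, by the axioms alone, into a normal form: the boxes one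
-- after another, each fed by copies of wires already present, followed by a rewiring made of copies,
-- discards and swaps. Box counts and parent sets are invariant under the axioms, so they can be read off
-- any normal form. When every label is the source of exactly one wire, the wires of a normal form carry
-- distinct labels, so rewirings are determined by their types and a box whose inputs are present can be
-- moved to the front; hence normal forms with the same boxes coincide, which makes D ↦ G_D injective.
-- The position of a box in a normal form strictly increases along the edges of G_D, so G_D is acyclic.
-- Conversely D_(G,I,O) adds the boxes along a topological order of G, which exists since G is acyclic,
-- so it is a network diagram whose open DAG is G.

module Submission where

open import Defs
open import Algebra using (CommutativeMonoid)
import Algebra.Properties.CommutativeSemigroup as CommutativeSemigroupProperties
open import Data.Bool using (Bool; true; false; if_then_else_; not; _∧_; _∨_)
open import Data.Bool.Properties using (∨-identityʳ)
open import Data.Bool.ListAction using (all)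
open import Data.Empty using (⊥-elim)
open import Data.Fin using (Fin; zero; suc; toℕ)
open import Data.Fin.Properties using (_≟_; pigeonhole)
open import Data.Fin.Subset using (Subset; ⊥; _∪_; _∈_)
open import Data.Fin.Subset.Properties
  using (∪-assoc; ∪-comm; ∪-identityˡ; ∪-identityʳ; ∪-commutativeMonoid; x∈p∪q⁻; ∉⊥)
open import Data.List using (List; []; _∷_; _++_; [_]; map; filterᵇ; allFin; tabulate; length)
open import Data.List.Properties using (++-assoc; ++-identityʳ; length-tabulate)
open import Data.Maybe using (just; nothing)
open import Data.Nat using (ℕ; zero; suc; _+_; _≤_; _<_; z≤n; s≤s; s≤s⁻¹)
open import Data.Nat.Properties
  using (+-assoc; +-comm; +-identityʳ; +-commutativeSemigroup; +-cancelˡ-≡; +-cancelʳ-≡; +-monoʳ-≤;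
         ≤-refl; ≤-reflexive; ≤-trans; ≤-antisym; <-trans; <-irrefl; n≤1+n; n<1+n; m≤n+m; n≤0⇒n≡0;
         m≤n⇒∃[o]m+o≡n; suc-injective; 1+n≢0)
open import Data.Product using (Σ; _×_; _,_; proj₁; proj₂)
open import Data.Sum using (inj₁; inj₂)
open import Data.Unit using (⊤; tt)
open import Data.Vec using (lookup) renaming (_∷_ to _∷ᵥ_)
import Data.Vec as Vec
open import Data.Vec.Properties using (lookup⇒[]=)
open import Relation.Nullary using (does; yes; no; ¬_)
open import Relation.Nullary.Decidable using (dec-true; dec-false)
open import Relation.Binary.PropositionalEquality
  using (_≡_; _≢_; refl; sym; trans; cong; cong₂; subst)

private variable
  a b c d e a′ b′ c′ d′ e′ b₁ b₂ c₁ c₂ d₁ d₂ : List (Fin n)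
  v x y : Fin n

private
  module +-Properties = CommutativeSemigroupProperties +-commutativeSemigroup
  module ∪-Properties {n : ℕ} =
    CommutativeSemigroupProperties (CommutativeMonoid.commutativeSemigroup (∪-commutativeMonoid n))

-- Invariants of the cd-axioms

data BoxFree {n : ℕ} : {a b : List (Fin n)} → Tm a b → Set where
  id  : ∀ a → BoxFree (id a)
  _⨾_ : {f : Tm a b} {g : Tm b c} → BoxFree f → BoxFree g → BoxFree (f ⨾ g)
  _⊗_ : {f : Tm a b} {g : Tm c d} → BoxFree f → BoxFree g → BoxFree (f ⊗ g)
  σ   : ∀ a b → BoxFree (σ a b)
  δ   : ∀ x → BoxFree (δ x)
  ε   : ∀ x → BoxFree (ε x)

boxFree-cast : (p : a ≡ b) → BoxFree (cast p)
boxFree-cast {a = a} refl = id a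

BoxFree⇒boxCount≡0 : {f : Tm a b} → BoxFree f → ∀ x → boxCount f x ≡ 0
BoxFree⇒boxCount≡0 (id _)  x = refl
BoxFree⇒boxCount≡0 (f ⨾ g) x = cong₂ _+_ (BoxFree⇒boxCount≡0 f x) (BoxFree⇒boxCount≡0 g x)
BoxFree⇒boxCount≡0 (f ⊗ g) x = cong₂ _+_ (BoxFree⇒boxCount≡0 f x) (BoxFree⇒boxCount≡0 g x)
BoxFree⇒boxCount≡0 (σ _ _) x = refl
BoxFree⇒boxCount≡0 (δ _)   x = refl
BoxFree⇒boxCount≡0 (ε _)   x = refl

BoxFree⇒parD≡⊥ : {f : Tm a b} → BoxFree f → ∀ y → parD f y ≡ ⊥
BoxFree⇒parD≡⊥ (id _)  y = refl
BoxFree⇒parD≡⊥ (f ⨾ g) y = trans (cong₂ _∪_ (BoxFree⇒parD≡⊥ f y) (BoxFree⇒parD≡⊥ g y)) (∪-identityˡ ⊥)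
BoxFree⇒parD≡⊥ (f ⊗ g) y = trans (cong₂ _∪_ (BoxFree⇒parD≡⊥ f y) (BoxFree⇒parD≡⊥ g y)) (∪-identityˡ ⊥)
BoxFree⇒parD≡⊥ (σ _ _) y = refl
BoxFree⇒parD≡⊥ (δ _)   y = refl
BoxFree⇒parD≡⊥ (ε _)   y = refl

boxCount-resp-≈ : {f : Tm a b} {g : Tm c d} → f ≈ g → ∀ x → boxCount f x ≡ boxCount g x
boxCount-resp-≈ ≈-refl                  x = refl
boxCount-resp-≈ (≈-sym e)               x = sym (boxCount-resp-≈ e x)
boxCount-resp-≈ (≈-trans e e′)          x = trans (boxCount-resp-≈ e x) (boxCount-resp-≈ e′ x)
boxCount-resp-≈ (⨾-cong e e′)           x = cong₂ _+_ (boxCount-resp-≈ e x) (boxCount-resp-≈ e′ x)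
boxCount-resp-≈ (⊗-cong e e′)           x = cong₂ _+_ (boxCount-resp-≈ e x) (boxCount-resp-≈ e′ x)
boxCount-resp-≈ (cast-id p)             x = BoxFree⇒boxCount≡0 (boxFree-cast p) x
boxCount-resp-≈ (idˡ f)                 x = refl
boxCount-resp-≈ (idʳ f)                 x = +-identityʳ _
boxCount-resp-≈ (⨾-assoc f g h)         x = +-assoc (boxCount f x) _ _
boxCount-resp-≈ (⊗-assoc f g h)         x = +-assoc (boxCount f x) _ _
boxCount-resp-≈ (⊗-unitˡ f)             x = refl
boxCount-resp-≈ (⊗-unitʳ f)             x = +-identityʳ _
boxCount-resp-≈ (⊗-id a b)              x = refl
boxCount-resp-≈ (interchange f g f′ g′) x = +-Properties.interchange (boxCount f x) _ _ _
boxCount-resp-≈ (σ-natural f g)         x = trans (+-identityʳ _) (+-comm (boxCount f x) _)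
boxCount-resp-≈ (σ-inv a b)             x = refl
boxCount-resp-≈ (σ-unitˡ a)             x = refl
boxCount-resp-≈ (σ-unitʳ a)             x = refl
boxCount-resp-≈ (σ-hexˡ a b c)          x =
  sym (BoxFree⇒boxCount≡0 ((σ a b ⊗ id c) ⨾ boxFree-cast (++-assoc b a c) ⨾ (id b ⊗ σ a c)) x)
boxCount-resp-≈ (σ-hexʳ a b c)          x =
  sym (BoxFree⇒boxCount≡0 (boxFree-cast (++-assoc a b c) ⨾ (id a ⊗ σ b c) ⨾
                           boxFree-cast (sym (++-assoc a c b)) ⨾ (σ a c ⊗ id b)) x)
boxCount-resp-≈ (δ-assoc _)             x = refl
boxCount-resp-≈ (δ-unitˡ _)             x = refl
boxCount-resp-≈ (δ-unitʳ _)             x = refl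
boxCount-resp-≈ (δ-comm _)              x = refl

parD-resp-≈ : {f : Tm a b} {g : Tm c d} → f ≈ g → ∀ y → parD f y ≡ parD g y
parD-resp-≈ ≈-refl                  y = refl
parD-resp-≈ (≈-sym e)               y = sym (parD-resp-≈ e y)
parD-resp-≈ (≈-trans e e′)          y = trans (parD-resp-≈ e y) (parD-resp-≈ e′ y)
parD-resp-≈ (⨾-cong e e′)           y = cong₂ _∪_ (parD-resp-≈ e y) (parD-resp-≈ e′ y)
parD-resp-≈ (⊗-cong e e′)           y = cong₂ _∪_ (parD-resp-≈ e y) (parD-resp-≈ e′ y)
parD-resp-≈ (cast-id p)             y = BoxFree⇒parD≡⊥ (boxFree-cast p) y
parD-resp-≈ (idˡ f)                 y = ∪-identityˡ _
parD-resp-≈ (idʳ f)                 y = ∪-identityʳ _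
parD-resp-≈ (⨾-assoc f g h)         y = ∪-assoc (parD f y) _ _
parD-resp-≈ (⊗-assoc f g h)         y = ∪-assoc (parD f y) _ _
parD-resp-≈ (⊗-unitˡ f)             y = ∪-identityˡ _
parD-resp-≈ (⊗-unitʳ f)             y = ∪-identityʳ _
parD-resp-≈ (⊗-id a b)              y = ∪-identityˡ ⊥
parD-resp-≈ (interchange f g f′ g′) y = ∪-Properties.interchange (parD f y) _ _ _
parD-resp-≈ (σ-natural f g)         y =
  trans (∪-identityʳ _) (trans (∪-comm (parD f y) _) (sym (∪-identityˡ _)))
parD-resp-≈ (σ-inv a b)             y = ∪-identityˡ ⊥
parD-resp-≈ (σ-unitˡ a)             y = refl
parD-resp-≈ (σ-unitʳ a)             y = refl
parD-resp-≈ (σ-hexˡ a b c)          y =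
  sym (BoxFree⇒parD≡⊥ ((σ a b ⊗ id c) ⨾ boxFree-cast (++-assoc b a c) ⨾ (id b ⊗ σ a c)) y)
parD-resp-≈ (σ-hexʳ a b c)          y =
  sym (BoxFree⇒parD≡⊥ (boxFree-cast (++-assoc a b c) ⨾ (id a ⊗ σ b c) ⨾
                       boxFree-cast (sym (++-assoc a c b)) ⨾ (σ a c ⊗ id b)) y)
parD-resp-≈ (δ-assoc _)             y = refl
parD-resp-≈ (δ-unitˡ x)             y = BoxFree⇒parD≡⊥ (δ x ⨾ (ε x ⊗ id [ x ])) y
parD-resp-≈ (δ-unitʳ x)             y = BoxFree⇒parD≡⊥ (δ x ⨾ (id [ x ] ⊗ ε x)) y
parD-resp-≈ (δ-comm x)              y = BoxFree⇒parD≡⊥ (δ x ⨾ σ [ x ] [ x ]) y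

≈-boundaries : {f : Tm a b} {g : Tm c d} → f ≈ g → a ≡ c × b ≡ d
≈-boundaries ≈-refl = refl , refl
≈-boundaries (≈-sym e) with ≈-boundaries e
... | p , q = sym p , sym q
≈-boundaries (≈-trans e e′) with ≈-boundaries e | ≈-boundaries e′
... | p , q | p′ , q′ = trans p p′ , trans q q′
≈-boundaries (⨾-cong e e′) = refl , refl
≈-boundaries (⊗-cong e e′) = refl , refl
≈-boundaries (cast-id p) = p , refl
≈-boundaries (idˡ f) = refl , refl
≈-boundaries (idʳ f) = refl , refl
≈-boundaries (⨾-assoc f g h) = refl , refl
≈-boundaries (⊗-assoc {a} {b} {c} {d} {e} {h} f g k) = ++-assoc a c e , ++-assoc b d h
≈-boundaries (⊗-unitˡ f) = refl , refl
≈-boundaries (⊗-unitʳ {a} {b} f) = ++-identityʳ a , ++-identityʳ b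
≈-boundaries (⊗-id a b) = refl , refl
≈-boundaries (interchange f g f′ g′) = refl , refl
≈-boundaries (σ-natural f g) = refl , refl
≈-boundaries (σ-inv a b) = refl , refl
≈-boundaries (σ-unitˡ a) = refl , ++-identityʳ a
≈-boundaries (σ-unitʳ a) = ++-identityʳ a , refl
≈-boundaries (σ-hexˡ a b c) = sym (++-assoc a b c) , ++-assoc b c a
≈-boundaries (σ-hexʳ a b c) = refl , sym (++-assoc c a b)
≈-boundaries (δ-assoc x) = refl , refl
≈-boundaries (δ-unitˡ x) = refl , refl
≈-boundaries (δ-unitʳ x) = refl , refl
≈-boundaries (δ-comm x) = refl , refl

infixr 9 _⟨⨾⟩_
infixr 10 _⟨⊗⟩_

_⟨⨾⟩_ : {f : Tm a b} {f′ : Tm a′ b′} {g : Tm b c} {g′ : Tm b′ c′} →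
        f ≈ f′ → g ≈ g′ → (f ⨾ g) ≈ (f′ ⨾ g′)
e ⟨⨾⟩ e′ with ≈-boundaries e | ≈-boundaries e′
... | refl , refl | refl , refl = ⨾-cong e e′

_⟨⊗⟩_ : {f : Tm a b} {f′ : Tm a′ b′} {g : Tm c d} {g′ : Tm c′ d′} →
        f ≈ f′ → g ≈ g′ → (f ⊗ g) ≈ (f′ ⊗ g′)
e ⟨⊗⟩ e′ with ≈-boundaries e | ≈-boundaries e′
... | refl , refl | refl , refl = ⊗-cong e e′

⨾-congˡ : {f : Tm a b} {g : Tm b c} {g′ : Tm b c′} → g ≈ g′ → (f ⨾ g) ≈ (f ⨾ g′)
⨾-congˡ e = ≈-refl ⟨⨾⟩ e

⨾-congʳ : {f f′ : Tm a b} {g : Tm b c} → f ≈ f′ → (f ⨾ g) ≈ (f′ ⨾ g)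
⨾-congʳ e = e ⟨⨾⟩ ≈-refl

module ≈-Reasoning where
  infix  1 begin_
  infixr 2 _≈⟨_⟩_
  infix  3 _∎

  begin_ : {f : Tm a b} {g : Tm c d} → f ≈ g → f ≈ g
  begin e = e

  _≈⟨_⟩_ : (f : Tm a b) {g : Tm c d} {h : Tm e a′} → f ≈ g → g ≈ h → f ≈ h
  f ≈⟨ e ⟩ e′ = ≈-trans e e′

  _∎ : (f : Tm a b) → f ≈ f
  f ∎ = ≈-refl

id-cong : a ≡ b → id a ≈ id b
id-cong refl = ≈-refl

cast-id′ : (p : a ≡ b) → cast p ≈ id a
cast-id′ refl = ≈-refl

cast-cong : (p : a ≡ b) (q : c ≡ d) → b ≡ d → cast p ≈ cast q
cast-cong p q r = ≈-trans (cast-id p) (≈-trans (id-cong r) (≈-sym (cast-id q)))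

⨾-cast : (f : Tm a b) (p : b ≡ c) → (f ⨾ cast p) ≈ f
⨾-cast f p = ≈-trans (⨾-congˡ (cast-id′ p)) (idʳ f)

cast-⨾ : (p : a ≡ b) (f : Tm b c) → (cast p ⨾ f) ≈ f
cast-⨾ p f = ≈-trans (cast-id p ⟨⨾⟩ ≈-refl) (idˡ f)

≈id-⨾ : {h : Tm a b} {g : Tm b c} → h ≈ id d → (h ⨾ g) ≈ g
≈id-⨾ {g = g} e with ≈-boundaries e
... | refl , refl = ≈-trans (⨾-cong e ≈-refl) (idˡ g)

⨾-≈id : {h : Tm b c} {f : Tm a b} → h ≈ id d → (f ⨾ h) ≈ f
⨾-≈id {f = f} e with ≈-boundaries e
... | refl , refl = ≈-trans (⨾-cong ≈-refl e) (idʳ f)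

⊗≈⊗id⨾id⊗ : (f : Tm a b) (g : Tm c d) → (f ⊗ g) ≈ ((f ⊗ id c) ⨾ (id b ⊗ g))
⊗≈⊗id⨾id⊗ f g = ≈-sym (≈-trans (interchange _ _ _ _) (idʳ f ⟨⊗⟩ idˡ g))

⊗≈id⊗⨾⊗id : (f : Tm a b) (g : Tm c d) → (f ⊗ g) ≈ ((id a ⊗ g) ⨾ (f ⊗ id d))
⊗≈id⊗⨾⊗id f g = ≈-sym (≈-trans (interchange _ _ _ _) (idˡ f ⟨⊗⟩ idʳ g))

id⊗-distrib-⨾ : (f : Tm b c) (g : Tm c d) → (id a ⊗ (f ⨾ g)) ≈ ((id a ⊗ f) ⨾ (id a ⊗ g))
id⊗-distrib-⨾ {a = a} f g = ≈-sym (≈-trans (interchange _ _ _ _) (idˡ (id a) ⟨⊗⟩ ≈-refl))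

⊗id-distrib-⨾ : (f : Tm b c) (g : Tm c d) → ((f ⨾ g) ⊗ id a) ≈ ((f ⊗ id a) ⨾ (g ⊗ id a))
⊗id-distrib-⨾ {a = a} f g = ≈-sym (≈-trans (interchange _ _ _ _) (≈-refl ⟨⊗⟩ idˡ (id a)))

id⊗id⊗ : (l m : List (Fin n)) (g : Tm a b) → (id l ⊗ (id m ⊗ g)) ≈ (id (l ++ m) ⊗ g)
id⊗id⊗ l m g = ≈-trans (≈-sym (⊗-assoc (id l) (id m) g)) (⊗-id l m ⟨⊗⟩ ≈-refl)

⊗id⊗id : (f : Tm a b) (l m : List (Fin n)) → ((f ⊗ id l) ⊗ id m) ≈ (f ⊗ id (l ++ m))
⊗id⊗id f l m = ≈-trans (⊗-assoc f (id l) (id m)) (≈-refl ⟨⊗⟩ ⊗-id l m)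

infixr 9 _⨾⟨_⟩_

_⨾⟨_⟩_ : Tm a b → b ≡ c → Tm c d → Tm a d
f ⨾⟨ p ⟩ g = f ⨾ (cast p ⨾ g)

⨾⟨⟩-cong : {f : Tm a b} {f′ : Tm a′ b′} {g : Tm c d} {g′ : Tm c′ d′} {p : b ≡ c} {p′ : b′ ≡ c′} →
           f ≈ f′ → g ≈ g′ → (f ⨾⟨ p ⟩ g) ≈ (f′ ⨾⟨ p′ ⟩ g′)
⨾⟨⟩-cong {p = p} {p′} e e′ = e ⟨⨾⟩ (cast-cong p p′ (proj₁ (≈-boundaries e′)) ⟨⨾⟩ e′)

⨾≈⨾⟨refl⟩ : (f : Tm a b) (g : Tm b c) → (f ⨾ g) ≈ (f ⨾⟨ refl ⟩ g)
⨾≈⨾⟨refl⟩ f g = ⨾-congˡ (≈-sym (idˡ g))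

⨾⟨⟩-assoc : (f : Tm a b) (p : b ≡ c) (g : Tm c d) (q : d ≡ e) (h : Tm e a′) →
            ((f ⨾⟨ p ⟩ g) ⨾⟨ q ⟩ h) ≈ (f ⨾⟨ p ⟩ (g ⨾⟨ q ⟩ h))
⨾⟨⟩-assoc f p g q h = ≈-trans (⨾-assoc _ _ _) (⨾-congˡ (⨾-assoc _ _ _))

⨾-≈id-⨾ : {h : Tm b c} {f : Tm a b} {g : Tm c d} (p : b ≡ c) → h ≈ id e → (f ⨾ (h ⨾ g)) ≈ (f ⨾⟨ p ⟩ g)
⨾-≈id-⨾ p e = ⨾-congˡ (≈-trans e (≈-sym (≈-trans (cast-id p) (id-cong (proj₂ (≈-boundaries e))))) ⟨⨾⟩ ≈-refl)

id⊗⊗id-distrib-⨾ : (l : List (Fin n)) (f : Tm b c) (g : Tm c d) (r : List (Fin n)) →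
                   (id l ⊗ ((f ⨾ g) ⊗ id r)) ≈ ((id l ⊗ (f ⊗ id r)) ⨾ (id l ⊗ (g ⊗ id r)))
id⊗⊗id-distrib-⨾ l f g r = ≈-trans (≈-refl ⟨⊗⟩ ⊗id-distrib-⨾ f g) (id⊗-distrib-⨾ _ _)

id⊗cast⊗id : (l : List (Fin n)) (p : a ≡ b) (r : List (Fin n)) → (id l ⊗ (cast p ⊗ id r)) ≈ id (l ++ (a ++ r))
id⊗cast⊗id l p r = ≈-trans (≈-refl ⟨⊗⟩ ≈-trans (cast-id′ p ⟨⊗⟩ ≈-refl) (⊗-id _ r)) (⊗-id l _)

⟨_,_⟩ : Tm a b → Tm a c → Tm a (b ++ c)
⟨_,_⟩ {a = a} f g = δs a ⨾ (f ⊗ g)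

middleFour : (b₁ c₁ b₂ c₂ : List (Fin n)) → Tm ((b₁ ++ c₁) ++ (b₂ ++ c₂)) ((b₁ ++ b₂) ++ (c₁ ++ c₂))
middleFour b₁ c₁ b₂ c₂ = cast (++-assoc b₁ c₁ (b₂ ++ c₂)) ⨾
  (id b₁ ⊗ (cast (sym (++-assoc c₁ b₂ c₂)) ⨾ (σ c₁ b₂ ⊗ id c₂) ⨾ cast (++-assoc b₂ c₁ c₂))) ⨾
  cast (sym (++-assoc b₁ b₂ (c₁ ++ c₂)))

middleFour≈ : (b₁ c₁ b₂ c₂ : List (Fin n)) → middleFour b₁ c₁ b₂ c₂ ≈ (id b₁ ⊗ (σ c₁ b₂ ⊗ id c₂))
middleFour≈ b₁ c₁ b₂ c₂ =
  ≈-trans (cast-⨾ _ _) (≈-trans (⨾-cast _ _) (≈-refl ⟨⊗⟩ ≈-trans (cast-⨾ _ _) (⨾-cast _ _)))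

middleFour-unitˡ : (b₁ b₂ c₂ : List (Fin n)) → middleFour b₁ [] b₂ c₂ ≈ id (b₁ ++ (b₂ ++ c₂))
middleFour-unitˡ b₁ b₂ c₂ = ≈-trans (middleFour≈ b₁ [] b₂ c₂)
  (≈-trans (≈-refl ⟨⊗⟩ ≈-trans (σ-unitˡ b₂ ⟨⊗⟩ ≈-refl) (⊗-id b₂ c₂)) (⊗-id b₁ (b₂ ++ c₂)))

middleFour-unitʳ : (b₁ c₁ c₂ : List (Fin n)) → middleFour b₁ c₁ [] c₂ ≈ id (b₁ ++ (c₁ ++ c₂))
middleFour-unitʳ b₁ c₁ c₂ = ≈-trans (middleFour≈ b₁ c₁ [] c₂)
  (≈-trans (≈-refl ⟨⊗⟩ ≈-trans (σ-unitʳ c₁ ⟨⊗⟩ ≈-refl) (⊗-id c₁ c₂)) (⊗-id b₁ (c₁ ++ c₂)))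

δs-∷-interchange : (z : Fin n) (a : List (Fin n))
  (f₁ : Tm [ z ] b₁) (f₂ : Tm a b₂) (g₁ : Tm [ z ] c₁) (g₂ : Tm a c₂) →
  ⟨ f₁ ⊗ f₂ , g₁ ⊗ g₂ ⟩ ≈ (((δ z ⨾ (f₁ ⊗ g₁)) ⊗ ⟨ f₂ , g₂ ⟩) ⨾ middleFour b₁ c₁ b₂ c₂)
δs-∷-interchange {b₁ = b₁} {b₂ = b₂} {c₁ = c₁} {c₂ = c₂} z a f₁ f₂ g₁ g₂ = begin
  ⟨ f₁ ⊗ f₂ , g₁ ⊗ g₂ ⟩
    ≈⟨ ⨾-assoc _ _ _ ⟩
  (δ z ⊗ δs a) ⨾ ((id [ z ] ⊗ ((σ [ z ] a ⊗ id a) ⨾ cast (++-assoc a [ z ] a))) ⨾ ((f₁ ⊗ f₂) ⊗ (g₁ ⊗ g₂)))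
    ≈⟨ ⨾-congˡ ((≈-refl ⟨⊗⟩ ⨾-cast _ _) ⟨⨾⟩
                ≈-trans (⊗-assoc f₁ f₂ (g₁ ⊗ g₂)) (≈-refl ⟨⊗⟩ ≈-sym (⊗-assoc f₂ g₁ g₂))) ⟩
  (δ z ⊗ δs a) ⨾ ((id [ z ] ⊗ (σ [ z ] a ⊗ id a)) ⨾ (f₁ ⊗ ((f₂ ⊗ g₁) ⊗ g₂)))
    ≈⟨ ⨾-congˡ (≈-trans (interchange _ _ _ _) (idˡ f₁ ⟨⊗⟩ interchange _ _ _ _)) ⟩
  (δ z ⊗ δs a) ⨾ (f₁ ⊗ ((σ [ z ] a ⨾ (f₂ ⊗ g₁)) ⊗ (id a ⨾ g₂)))
    ≈⟨ ⨾-congˡ (≈-sym (idʳ f₁) ⟨⊗⟩ (≈-sym (σ-natural g₁ f₂) ⟨⊗⟩ ≈-trans (idˡ g₂) (≈-sym (idʳ g₂)))) ⟩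
  (δ z ⊗ δs a) ⨾ ((f₁ ⨾ id b₁) ⊗ (((g₁ ⊗ f₂) ⨾ σ c₁ b₂) ⊗ (g₂ ⨾ id c₂)))
    ≈⟨ ⨾-congˡ (≈-sym (≈-trans (interchange _ _ _ _) (≈-refl ⟨⊗⟩ interchange _ _ _ _))) ⟩
  (δ z ⊗ δs a) ⨾ ((f₁ ⊗ ((g₁ ⊗ f₂) ⊗ g₂)) ⨾ (id b₁ ⊗ (σ c₁ b₂ ⊗ id c₂)))
    ≈⟨ ⨾-congˡ (≈-sym (≈-trans (⊗-assoc f₁ g₁ (f₂ ⊗ g₂)) (≈-refl ⟨⊗⟩ ≈-sym (⊗-assoc g₁ f₂ g₂)))
                ⟨⨾⟩ ≈-sym (middleFour≈ b₁ c₁ b₂ c₂)) ⟩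
  (δ z ⊗ δs a) ⨾ (((f₁ ⊗ g₁) ⊗ (f₂ ⊗ g₂)) ⨾ middleFour b₁ c₁ b₂ c₂)
    ≈⟨ ≈-sym (⨾-assoc _ _ _) ⟩
  ((δ z ⊗ δs a) ⨾ ((f₁ ⊗ g₁) ⊗ (f₂ ⊗ g₂))) ⨾ middleFour b₁ c₁ b₂ c₂
    ≈⟨ ⨾-congʳ (interchange _ _ _ _) ⟩
  ((δ z ⨾ (f₁ ⊗ g₁)) ⊗ ⟨ f₂ , g₂ ⟩) ⨾ middleFour b₁ c₁ b₂ c₂ ∎
  where open ≈-Reasoning

δs-unitˡ : (a : List (Fin n)) → ⟨ εs a , id a ⟩ ≈ id a
δs-unitˡ [] = ≈-trans (idˡ _) (⊗-id [] [])
δs-unitˡ (z ∷ a) =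
  ≈-trans (⨾-congˡ (≈-refl ⟨⊗⟩ ≈-sym (⊗-id [ z ] a)))
  (≈-trans (δs-∷-interchange z a (ε z) (εs a) (id [ z ]) (id a))
  (≈-trans ((δ-unitˡ z ⟨⊗⟩ δs-unitˡ a) ⟨⨾⟩ middleFour-unitʳ [] [ z ] a)
  (≈-trans (idʳ _) (⊗-id [ z ] a))))

δs-unitʳ : (a : List (Fin n)) → ⟨ id a , εs a ⟩ ≈ id a
δs-unitʳ [] = ≈-trans (idˡ _) (⊗-id [] [])
δs-unitʳ (z ∷ a) =
  ≈-trans (⨾-congˡ (≈-sym (⊗-id [ z ] a) ⟨⊗⟩ ≈-refl))
  (≈-trans (δs-∷-interchange z a (id [ z ]) (id a) (ε z) (εs a))
  (≈-trans ((δ-unitʳ z ⟨⊗⟩ δs-unitʳ a) ⟨⨾⟩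
            ≈-trans (middleFour-unitˡ [ z ] a []) (id-cong (cong (z ∷_) (++-identityʳ a))))
  (≈-trans (idʳ _) (⊗-id [ z ] a))))

pair-discardˡ : (g : Tm a b) → ⟨ εs a , g ⟩ ≈ g
pair-discardˡ {a = a} g =
  ≈-trans (⨾-congˡ (⊗≈⊗id⨾id⊗ (εs a) g))
  (≈-trans (≈-sym (⨾-assoc _ _ _))
  (≈-trans (⨾-congʳ (δs-unitˡ a)) (≈-trans (idˡ _) (⊗-unitˡ g))))

pair-discardʳ : (f : Tm a b) → ⟨ f , εs a ⟩ ≈ f
pair-discardʳ {a = a} f =
  ≈-trans (⨾-congˡ (⊗≈id⊗⨾⊗id f (εs a)))
  (≈-trans (≈-sym (⨾-assoc _ _ _))
  (≈-trans (δs-unitʳ a ⟨⨾⟩ ⊗-unitʳ f) (idˡ f)))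

δ-⨾-ε⊗ε : (x : Fin n) → (δ x ⨾ (ε x ⊗ ε x)) ≈ ε x
δ-⨾-ε⊗ε x = ≈-trans (⨾-congˡ (⊗≈⊗id⨾id⊗ (ε x) (ε x)))
  (≈-trans (≈-sym (⨾-assoc _ _ _)) (≈-trans (⨾-congʳ (δ-unitˡ x)) (≈-trans (idˡ _) (⊗-unitˡ (ε x)))))

private
  -- Both sides of `coherence` reorder the wires z z z a a a into z a z a z a.
  module Coassociativity (z : Fin n) (a : List (Fin n)) where
    s : Tm (z ∷ a) (a ++ [ z ])
    s = σ [ z ] a

    shuffle : Tm (z ∷ z ∷ (a ++ a)) (z ∷ (a ++ z ∷ a))
    shuffle = id [ z ] ⊗ ((s ⊗ id a) ⨾ cast (++-assoc a [ z ] a))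

    T : Tm (z ∷ z ∷ z ∷ (a ++ (a ++ a))) (z ∷ z ∷ ((a ++ [ z ]) ++ (a ++ a)))
    T = id [ z ] ⊗ (id [ z ] ⊗ (s ⊗ id (a ++ a)))

    A : Tm (z ∷ z ∷ (a ++ (z ∷ (a ++ a)))) (z ∷ z ∷ (a ++ ((a ++ [ z ]) ++ a)))
    A = id [ z ] ⊗ (id [ z ] ⊗ (id a ⊗ (s ⊗ id a)))

    B : Tm (z ∷ z ∷ (a ++ ((a ++ [ z ]) ++ a))) (z ∷ ((a ++ [ z ]) ++ ((a ++ [ z ]) ++ a)))
    B = id [ z ] ⊗ (s ⊗ id ((a ++ [ z ]) ++ a))

    B′ : Tm (z ∷ z ∷ (a ++ (z ∷ (a ++ a)))) (z ∷ ((a ++ [ z ]) ++ (z ∷ (a ++ a))))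
    B′ = id [ z ] ⊗ (s ⊗ id (z ∷ (a ++ a)))

    A′ : Tm (z ∷ ((a ++ [ z ]) ++ (z ∷ (a ++ a)))) (z ∷ ((a ++ [ z ]) ++ ((a ++ [ z ]) ++ a)))
    A′ = id [ z ] ⊗ (id (a ++ [ z ]) ⊗ (s ⊗ id a))

    p : z ∷ z ∷ ((a ++ [ z ]) ++ (a ++ a)) ≡ z ∷ z ∷ (a ++ (z ∷ (a ++ a)))
    p = cong (λ w → z ∷ z ∷ w) (++-assoc a [ z ] (a ++ a))

    middleˡ : Tm (z ∷ z ∷ z ∷ ((a ++ a) ++ a)) (z ∷ z ∷ ((a ++ a) ++ (z ∷ a)))
    middleˡ = middleFour (z ∷ z ∷ []) [ z ] (a ++ a) a

    middleʳ : Tm (z ∷ z ∷ z ∷ (a ++ (a ++ a))) (z ∷ (a ++ (z ∷ z ∷ (a ++ a))))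
    middleʳ = middleFour [ z ] (z ∷ z ∷ []) a (a ++ a)

    A⨾B≈B′⨾A′ : (A ⨾ B) ≈ (B′ ⨾ A′)
    A⨾B≈B′⨾A′ =
      ≈-trans ((≈-refl ⟨⊗⟩ id⊗id⊗ [ z ] a (s ⊗ id a)) ⟨⨾⟩ ≈-refl)
      (≈-trans (≈-sym (id⊗-distrib-⨾ _ _))
      (≈-trans (≈-refl ⟨⊗⟩ ≈-trans (≈-sym (⊗≈id⊗⨾⊗id s (s ⊗ id a))) (⊗≈⊗id⨾id⊗ s (s ⊗ id a)))
      (id⊗-distrib-⨾ _ _)))

    middleˡ≈ : middleˡ ≈ (T ⨾⟨ p ⟩ A)
    middleˡ≈ = begin
      middleˡ
        ≈⟨ middleFour≈ (z ∷ z ∷ []) [ z ] (a ++ a) a ⟩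
      id (z ∷ z ∷ []) ⊗ (σ [ z ] (a ++ a) ⊗ id a)
        ≈⟨ ≈-refl ⟨⊗⟩ (σ-hexˡ [ z ] a a ⟨⊗⟩ ≈-refl) ⟩
      id (z ∷ z ∷ []) ⊗ (((s ⊗ id a) ⨾ (cast (++-assoc a [ z ] a) ⨾ (id a ⊗ s))) ⊗ id a)
        ≈⟨ ≈-trans (id⊗⊗id-distrib-⨾ (z ∷ z ∷ []) _ _ a) (⨾-congˡ (id⊗⊗id-distrib-⨾ (z ∷ z ∷ []) _ _ a)) ⟩
      (id (z ∷ z ∷ []) ⊗ ((s ⊗ id a) ⊗ id a)) ⨾
        ((id (z ∷ z ∷ []) ⊗ (cast (++-assoc a [ z ] a) ⊗ id a)) ⨾ (id (z ∷ z ∷ []) ⊗ ((id a ⊗ s) ⊗ id a)))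
        ≈⟨ ⨾-≈id-⨾ (cong (λ w → z ∷ z ∷ (w ++ a)) (++-assoc a [ z ] a))
                   (id⊗cast⊗id (z ∷ z ∷ []) (++-assoc a [ z ] a) a) ⟩
      (id (z ∷ z ∷ []) ⊗ ((s ⊗ id a) ⊗ id a)) ⨾⟨ cong (λ w → z ∷ z ∷ (w ++ a)) (++-assoc a [ z ] a) ⟩
        (id (z ∷ z ∷ []) ⊗ ((id a ⊗ s) ⊗ id a))
        ≈⟨ ⨾⟨⟩-cong (≈-trans (≈-refl ⟨⊗⟩ ⊗id⊗id s a a) (≈-sym (id⊗id⊗ [ z ] [ z ] _)))
                    (≈-trans (≈-refl ⟨⊗⟩ ⊗-assoc (id a) s (id a)) (≈-sym (id⊗id⊗ [ z ] [ z ] _))) ⟩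
      T ⨾⟨ p ⟩ A ∎
      where open ≈-Reasoning

    middleʳ≈ : middleʳ ≈ (T ⨾⟨ p ⟩ B′)
    middleʳ≈ = begin
      middleʳ
        ≈⟨ middleFour≈ [ z ] (z ∷ z ∷ []) a (a ++ a) ⟩
      id [ z ] ⊗ (σ (z ∷ z ∷ []) a ⊗ id (a ++ a))
        ≈⟨ ≈-refl ⟨⊗⟩ (σ-hexʳ [ z ] [ z ] a ⟨⊗⟩ ≈-refl) ⟩
      id [ z ] ⊗ ((cast (++-assoc [ z ] [ z ] a) ⨾ (id [ z ] ⊗ s) ⨾
                   cast (sym (++-assoc [ z ] a [ z ])) ⨾ (s ⊗ id [ z ])) ⊗ id (a ++ a))
        ≈⟨ ≈-trans (id⊗⊗id-distrib-⨾ [ z ] _ _ (a ++ a))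
             (⨾-congˡ (≈-trans (id⊗⊗id-distrib-⨾ [ z ] _ _ (a ++ a)) (⨾-congˡ (id⊗⊗id-distrib-⨾ [ z ] _ _ (a ++ a))))) ⟩
      (id [ z ] ⊗ (cast (++-assoc [ z ] [ z ] a) ⊗ id (a ++ a))) ⨾ ((id [ z ] ⊗ ((id [ z ] ⊗ s) ⊗ id (a ++ a))) ⨾
        ((id [ z ] ⊗ (cast (sym (++-assoc [ z ] a [ z ])) ⊗ id (a ++ a))) ⨾ (id [ z ] ⊗ ((s ⊗ id [ z ]) ⊗ id (a ++ a)))))
        ≈⟨ ≈id-⨾ (id⊗cast⊗id [ z ] (++-assoc [ z ] [ z ] a) (a ++ a)) ⟩
      (id [ z ] ⊗ ((id [ z ] ⊗ s) ⊗ id (a ++ a))) ⨾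
        ((id [ z ] ⊗ (cast (sym (++-assoc [ z ] a [ z ])) ⊗ id (a ++ a))) ⨾ (id [ z ] ⊗ ((s ⊗ id [ z ]) ⊗ id (a ++ a))))
        ≈⟨ ⨾-≈id-⨾ refl (id⊗cast⊗id [ z ] (sym (++-assoc [ z ] a [ z ])) (a ++ a)) ⟩
      (id [ z ] ⊗ ((id [ z ] ⊗ s) ⊗ id (a ++ a))) ⨾⟨ refl ⟩ (id [ z ] ⊗ ((s ⊗ id [ z ]) ⊗ id (a ++ a)))
        ≈⟨ ⨾⟨⟩-cong (≈-refl ⟨⊗⟩ ⊗-assoc (id [ z ]) s (id (a ++ a))) (≈-refl ⟨⊗⟩ ⊗id⊗id s [ z ] (a ++ a)) ⟩
      T ⨾⟨ p ⟩ B′ ∎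
      where open ≈-Reasoning

    shuffle⊗id≈B : (shuffle ⊗ id (z ∷ a)) ≈ B
    shuffle⊗id≈B =
      ≈-trans ((≈-refl ⟨⊗⟩ ⨾-cast _ (++-assoc a [ z ] a)) ⟨⊗⟩ ≈-refl)
      (≈-trans (⊗-assoc (id [ z ]) (s ⊗ id a) (id (z ∷ a)))
      (≈-refl ⟨⊗⟩ ≈-trans (⊗id⊗id s a (z ∷ a)) (≈-refl ⟨⊗⟩ id-cong (sym (++-assoc a [ z ] a)))))

    id⊗shuffle≈A′ : (id (z ∷ a) ⊗ shuffle) ≈ A′
    id⊗shuffle≈A′ =
      ≈-trans (≈-refl ⟨⊗⟩ (≈-refl ⟨⊗⟩ ⨾-cast _ (++-assoc a [ z ] a)))
      (≈-trans (id⊗id⊗ (z ∷ a) [ z ] (s ⊗ id a))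
      (≈-sym (id⊗id⊗ [ z ] (a ++ [ z ]) (s ⊗ id a))))

    coherence : (middleˡ ⨾ (shuffle ⊗ id (z ∷ a))) ≈ (middleʳ ⨾ (id (z ∷ a) ⊗ shuffle))
    coherence = begin
      middleˡ ⨾ (shuffle ⊗ id (z ∷ a))  ≈⟨ ⨾≈⨾⟨refl⟩ _ _ ⟩
      middleˡ ⨾⟨ refl ⟩ (shuffle ⊗ id (z ∷ a))  ≈⟨ ⨾⟨⟩-cong middleˡ≈ shuffle⊗id≈B ⟩
      (T ⨾⟨ p ⟩ A) ⨾⟨ refl ⟩ B  ≈⟨ ⨾⟨⟩-assoc _ _ _ _ _ ⟩
      T ⨾⟨ p ⟩ (A ⨾⟨ refl ⟩ B)
        ≈⟨ ⨾⟨⟩-cong ≈-refl (≈-trans (≈-sym (⨾≈⨾⟨refl⟩ _ _)) (≈-trans A⨾B≈B′⨾A′ (⨾≈⨾⟨refl⟩ _ _))) ⟩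
      T ⨾⟨ p ⟩ (B′ ⨾⟨ refl ⟩ A′)  ≈⟨ ≈-sym (⨾⟨⟩-assoc _ _ _ _ _) ⟩
      (T ⨾⟨ p ⟩ B′) ⨾⟨ refl ⟩ A′  ≈⟨ ⨾⟨⟩-cong (≈-sym middleʳ≈) (≈-sym id⊗shuffle≈A′) ⟩
      middleʳ ⨾⟨ refl ⟩ (id (z ∷ a) ⊗ shuffle)  ≈⟨ ≈-sym (⨾≈⨾⟨refl⟩ _ _) ⟩
      middleʳ ⨾ (id (z ∷ a) ⊗ shuffle) ∎
      where open ≈-Reasoning

δs-assoc : (a : List (Fin n)) → ⟨ δs a , id a ⟩ ≈ ⟨ id a , δs a ⟩
δs-assoc [] = ≈-refl
δs-assoc (z ∷ a) = begin
  δs (z ∷ a) ⨾ (δs (z ∷ a) ⊗ id (z ∷ a))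
    ≈⟨ ⨾-congˡ (≈-sym (≈-trans (interchange _ _ _ _) (≈-refl ⟨⊗⟩ ≈-trans (idʳ _) (⊗-id [ z ] a)))) ⟩
  δs (z ∷ a) ⨾ (((δ z ⊗ δs a) ⊗ (id [ z ] ⊗ id a)) ⨾ (shuffle ⊗ id (z ∷ a)))
    ≈⟨ ≈-trans (≈-sym (⨾-assoc _ _ _)) (⨾-congʳ (δs-∷-interchange z a (δ z) (δs a) (id [ z ]) (id a))) ⟩
  (((δ z ⨾ (δ z ⊗ id [ z ])) ⊗ ⟨ δs a , id a ⟩) ⨾ middleˡ) ⨾ (shuffle ⊗ id (z ∷ a))
    ≈⟨ ⨾-assoc _ _ _ ⟩
  ((δ z ⨾ (δ z ⊗ id [ z ])) ⊗ ⟨ δs a , id a ⟩) ⨾ (middleˡ ⨾ (shuffle ⊗ id (z ∷ a)))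
    ≈⟨ (δ-assoc z ⟨⊗⟩ δs-assoc a) ⟨⨾⟩ coherence ⟩
  ((δ z ⨾ (id [ z ] ⊗ δ z)) ⊗ ⟨ id a , δs a ⟩) ⨾ (middleʳ ⨾ (id (z ∷ a) ⊗ shuffle))
    ≈⟨ ≈-sym (⨾-assoc _ _ _) ⟩
  (((δ z ⨾ (id [ z ] ⊗ δ z)) ⊗ ⟨ id a , δs a ⟩) ⨾ middleʳ) ⨾ (id (z ∷ a) ⊗ shuffle)
    ≈⟨ ≈-trans (⨾-congʳ (≈-sym (δs-∷-interchange z a (id [ z ]) (id a) (δ z) (δs a)))) (⨾-assoc _ _ _) ⟩
  δs (z ∷ a) ⨾ (((id [ z ] ⊗ id a) ⊗ (δ z ⊗ δs a)) ⨾ (id (z ∷ a) ⊗ shuffle))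
    ≈⟨ ⨾-congˡ (≈-trans (interchange _ _ _ _) (≈-trans (idʳ _) (⊗-id [ z ] a) ⟨⊗⟩ ≈-refl)) ⟩
  δs (z ∷ a) ⨾ (id (z ∷ a) ⊗ δs (z ∷ a)) ∎
  where open ≈-Reasoning
        open Coassociativity z a

pair-assoc : (f : Tm c b₁) (g : Tm c b₂) (h : Tm c c₁) → ⟨ f , ⟨ g , h ⟩ ⟩ ≈ ⟨ ⟨ f , g ⟩ , h ⟩
pair-assoc {c = c} f g h =
  ≈-trans (⨾-congˡ (≈-sym (≈-trans (interchange _ _ _ _) (idˡ f ⟨⊗⟩ ≈-refl))))
  (≈-trans (≈-sym (⨾-assoc _ _ _))
  (≈-trans (≈-sym (δs-assoc c) ⟨⨾⟩ ≈-sym (⊗-assoc f g h))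
  (≈-trans (⨾-assoc _ _ _)
  (⨾-congˡ (≈-trans (interchange _ _ _ _) (≈-refl ⟨⊗⟩ idˡ h))))))

data Wire {n : ℕ} : List (Fin n) → Fin n → Set where
  here  : ∀ {x a} → Wire (x ∷ a) x
  there : ∀ {x y a} → Wire a y → Wire (x ∷ a) y

data Selection {n : ℕ} (c : List (Fin n)) : List (Fin n) → Set where
  []  : Selection c []
  _∷_ : ∀ {y b} → Wire c y → Selection c b → Selection c (y ∷ b)

pick : ∀ {y} → Wire a y → Tm a [ y ]
pick (here {x} {a}) = id [ x ] ⊗ εs a
pick (there {x} w)  = ε x ⊗ pick w

rewire : Selection c b → Tm c b
rewire {c = c} []      = εs c
rewire         (w ∷ φ) = ⟨ pick w , rewire φ ⟩

pick-⨾-ε : ∀ {y} (w : Wire a y) → (pick w ⨾ ε y) ≈ εs a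
pick-⨾-ε (here {x} {a}) =
  ≈-trans (⨾-congˡ (≈-sym (⊗-unitʳ (ε x)))) (≈-trans (interchange _ _ _ _) (idˡ _ ⟨⊗⟩ idʳ _))
pick-⨾-ε {y = y} (there {x} w) =
  ≈-trans (⨾-congˡ (≈-sym (⊗-unitˡ (ε y)))) (≈-trans (interchange _ _ _ _) (idʳ _ ⟨⊗⟩ pick-⨾-ε w))

pick-⨾-δ : ∀ {y} (w : Wire a y) → (pick w ⨾ δ y) ≈ ⟨ pick w , pick w ⟩
pick-⨾-δ (here {x} {a}) =
  ≈-trans (⨾-congˡ (≈-sym (⊗-unitʳ (δ x))))
  (≈-trans (interchange _ _ _ _)
  (≈-trans (idˡ _ ⟨⊗⟩ idʳ _)
  (≈-sym (≈-trans (δs-∷-interchange x a (id [ x ]) (εs a) (id [ x ]) (εs a))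
          (≈-trans ((≈-trans (⨾-congˡ (⊗-id [ x ] [ x ])) (idʳ _) ⟨⊗⟩ pair-discardˡ (εs a)) ⟨⨾⟩
                    middleFour-unitʳ [ x ] [ x ] [])
          (idʳ _))))))
pick-⨾-δ {y = y} (there {x} {a = a} w) =
  ≈-trans (⨾-congˡ (≈-sym (⊗-unitˡ (δ y))))
  (≈-trans (interchange _ _ _ _)
  (≈-trans (idʳ _ ⟨⊗⟩ pick-⨾-δ w)
  (≈-sym (≈-trans (δs-∷-interchange x a (ε x) (pick w) (ε x) (pick w))
          (≈-trans ((δ-⨾-ε⊗ε x ⟨⊗⟩ ≈-refl) ⟨⨾⟩ middleFour-unitˡ [] [ y ] [ y ])
          (idʳ _))))))

infixr 5 _++ˢ_
_++ˢ_ : Selection c b → Selection c d → Selection c (b ++ d)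
[]      ++ˢ ψ = ψ
(w ∷ φ) ++ˢ ψ = w ∷ (φ ++ˢ ψ)

rewire-++ˢ : (φ : Selection c b) (ψ : Selection c d) → rewire (φ ++ˢ ψ) ≈ ⟨ rewire φ , rewire ψ ⟩
rewire-++ˢ []      ψ = ≈-sym (pair-discardˡ (rewire ψ))
rewire-++ˢ (w ∷ φ) ψ = ≈-trans (⨾-congˡ (≈-refl ⟨⊗⟩ rewire-++ˢ φ ψ)) (pair-assoc (pick w) (rewire φ) (rewire ψ))

rewire-single : ∀ {y} (w : Wire c y) → rewire (w ∷ []) ≈ pick w
rewire-single w = pair-discardʳ (pick w)

rewire-pair : ∀ {x y} (v : Wire c x) (w : Wire c y) → rewire (v ∷ w ∷ []) ≈ ⟨ pick v , pick w ⟩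
rewire-pair v w = ⨾-congˡ (≈-refl ⟨⊗⟩ rewire-single w)

private
  pair-pick-here-here : ∀ {z : Fin n} {c} →
    ⟨ pick (here {x = z} {a = c}) , pick here ⟩ ≈ (δ z ⊗ εs c)
  pair-pick-here-here {z = z} {c} =
    ≈-trans (δs-∷-interchange z c (id [ z ]) (εs c) (id [ z ]) (εs c))
    (≈-trans ((≈-trans (⨾-congˡ (⊗-id [ z ] [ z ])) (idʳ _) ⟨⊗⟩ pair-discardˡ (εs c)) ⟨⨾⟩
              middleFour-unitʳ [ z ] [ z ] [])
    (idʳ _))

  pair-pick-here-there : ∀ {z : Fin n} {c y} (w : Wire c y) →
    ⟨ pick (here {x = z}) , pick (there w) ⟩ ≈ (id [ z ] ⊗ pick w)
  pair-pick-here-there {z = z} {c} w =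
    ≈-trans (δs-∷-interchange z c (id [ z ]) (εs c) (ε z) (pick w))
    (≈-trans ((δ-unitʳ z ⟨⊗⟩ pair-discardˡ (pick w)) ⟨⨾⟩ middleFour-unitʳ [ z ] [] _) (idʳ _))

  pair-pick-there-here : ∀ {z : Fin n} {c y} (w : Wire c y) →
    ⟨ pick (there w) , pick (here {x = z}) ⟩ ≈ ((id [ z ] ⊗ pick w) ⨾ σ [ z ] [ y ])
  pair-pick-there-here {z = z} {c} {y} w =
    ≈-trans (δs-∷-interchange z c (ε z) (pick w) (id [ z ]) (εs c))
    ((δ-unitˡ z ⟨⊗⟩ pair-discardʳ (pick w)) ⟨⨾⟩
     ≈-trans (middleFour≈ [] [ z ] [ y ] []) (≈-trans (⊗-unitˡ _) (⊗-unitʳ _)))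

  pair-pick-there-there : ∀ {z : Fin n} {c x y} (v : Wire c x) (w : Wire c y) →
    ⟨ pick (there {x = z} v) , pick (there w) ⟩ ≈ (ε z ⊗ ⟨ pick v , pick w ⟩)
  pair-pick-there-there {z = z} {c} {x} {y} v w =
    ≈-trans (δs-∷-interchange z c (ε z) (pick v) (ε z) (pick w))
    (≈-trans ((δ-⨾-ε⊗ε z ⟨⊗⟩ ≈-refl) ⟨⨾⟩ middleFour-unitˡ [] [ x ] [ y ]) (idʳ _))

pair-pick-comm : ∀ {x y} (v : Wire c x) (w : Wire c y) → (⟨ pick v , pick w ⟩ ⨾ σ [ x ] [ y ]) ≈ ⟨ pick w , pick v ⟩
pair-pick-comm (here {z}) here =
  ≈-trans (pair-pick-here-here ⟨⨾⟩ ≈-sym (⊗-unitʳ (σ [ z ] [ z ])))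
  (≈-trans (interchange _ _ _ _) (≈-trans (δ-comm z ⟨⊗⟩ idʳ _) (≈-sym pair-pick-here-here)))
pair-pick-comm here (there w) = ≈-trans (⨾-congʳ (pair-pick-here-there w)) (≈-sym (pair-pick-there-here w))
pair-pick-comm (there {z} {x} v) here =
  ≈-trans (⨾-congʳ (pair-pick-there-here v))
  (≈-trans (⨾-assoc _ _ _)
  (≈-trans (⨾-congˡ (σ-inv [ z ] [ x ])) (≈-trans (idʳ _) (≈-sym (pair-pick-here-there v)))))
pair-pick-comm {x = x} {y} (there {z} v) (there w) =
  ≈-trans (pair-pick-there-there v w ⟨⨾⟩ ≈-sym (⊗-unitˡ (σ [ x ] [ y ])))
  (≈-trans (interchange _ _ _ _)
  (≈-trans (idʳ _ ⟨⊗⟩ pair-pick-comm v w) (≈-sym (pair-pick-there-there w v))))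

thereˢ : ∀ {z : Fin n} → Selection c b → Selection (z ∷ c) b
thereˢ []      = []
thereˢ (w ∷ φ) = there w ∷ thereˢ φ

rewire-thereˢ : ∀ {z : Fin n} (φ : Selection c b) → rewire (thereˢ {z = z} φ) ≈ (ε z ⊗ rewire φ)
rewire-thereˢ []  = ≈-refl
rewire-thereˢ {c = c} {z = z} (_∷_ {y} {b} w φ) =
  ≈-trans (⨾-congˡ (≈-refl ⟨⊗⟩ rewire-thereˢ φ))
  (≈-trans (δs-∷-interchange z c (ε z) (pick w) (ε z) (rewire φ))
  (≈-trans ((δ-⨾-ε⊗ε z ⟨⊗⟩ ≈-refl) ⟨⨾⟩ middleFour-unitˡ [] [ y ] b) (idʳ _)))

rewire-here∷thereˢ : ∀ {z : Fin n} (φ : Selection c b) → rewire (here {x = z} ∷ thereˢ φ) ≈ (id [ z ] ⊗ rewire φ)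
rewire-here∷thereˢ {c = c} {b} {z} φ =
  ≈-trans (⨾-congˡ (≈-refl ⟨⊗⟩ rewire-thereˢ φ))
  (≈-trans (δs-∷-interchange z c (id [ z ]) (εs c) (ε z) (rewire φ))
  (≈-trans ((δ-unitʳ z ⟨⊗⟩ pair-discardˡ (rewire φ)) ⟨⨾⟩ middleFour-unitʳ [ z ] [] b) (idʳ _)))

idˢ : (c : List (Fin n)) → Selection c c
idˢ []      = []
idˢ (z ∷ c) = here ∷ thereˢ (idˢ c)

rewire-idˢ : (c : List (Fin n)) → rewire (idˢ c) ≈ id c
rewire-idˢ []      = ≈-refl
rewire-idˢ (z ∷ c) = ≈-trans (rewire-here∷thereˢ (idˢ c)) (≈-trans (≈-refl ⟨⊗⟩ rewire-idˢ c) (⊗-id [ z ] c))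

rewire-++ˢ-assoc : (φ : Selection c b) (ψ : Selection c d) (χ : Selection c e) →
                   rewire ((φ ++ˢ ψ) ++ˢ χ) ≈ rewire (φ ++ˢ (ψ ++ˢ χ))
rewire-++ˢ-assoc []      ψ χ = ≈-refl
rewire-++ˢ-assoc (w ∷ φ) ψ χ = ⨾-congˡ (≈-refl ⟨⊗⟩ rewire-++ˢ-assoc φ ψ χ)

rewire-++ˢ-[] : (φ : Selection c b) → rewire (φ ++ˢ []) ≈ rewire φ
rewire-++ˢ-[] []      = ≈-refl
rewire-++ˢ-[] (w ∷ φ) = ⨾-congˡ (≈-refl ⟨⊗⟩ rewire-++ˢ-[] φ)

rewire-∷-⨾-id⊗ : ∀ {x b′} (w : Wire c x) (φ : Selection c b) (g : Tm b b′) →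
                 (rewire (w ∷ φ) ⨾ (id [ x ] ⊗ g)) ≈ ⟨ pick w , rewire φ ⨾ g ⟩
rewire-∷-⨾-id⊗ w φ g = ≈-trans (⨾-assoc _ _ _) (⨾-congˡ (≈-trans (interchange _ _ _ _) (idʳ _ ⟨⊗⟩ ≈-refl)))

rewire-∷-⨾-σ : ∀ {x} (w : Wire c x) (φ : Selection c b) → (rewire (w ∷ φ) ⨾ σ [ x ] b) ≈ rewire (φ ++ˢ (w ∷ []))
rewire-∷-⨾-σ w [] = ⨾-≈id (σ-unitʳ _)
rewire-∷-⨾-σ {c = c} {x = x} w (_∷_ {y} {b} v φ) = begin
  rewire (w ∷ v ∷ φ) ⨾ σ [ x ] (y ∷ b)
    ≈⟨ rewire-++ˢ (w ∷ v ∷ []) φ ⟨⨾⟩ σ-hexˡ [ x ] [ y ] b ⟩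
  ⟨ rewire (w ∷ v ∷ []) , rewire φ ⟩ ⨾ ((σ [ x ] [ y ] ⊗ id b) ⨾ (cast (++-assoc [ y ] [ x ] b) ⨾ (id [ y ] ⊗ σ [ x ] b)))
    ≈⟨ ≈-trans (≈-sym (⨾-assoc _ _ _)) (⨾-congʳ (⨾-assoc _ _ _)) ⟩
  (δs c ⨾ ((rewire (w ∷ v ∷ []) ⊗ rewire φ) ⨾ (σ [ x ] [ y ] ⊗ id b))) ⨾ (cast (++-assoc [ y ] [ x ] b) ⨾ (id [ y ] ⊗ σ [ x ] b))
    ≈⟨ ⨾-congˡ (≈-trans (interchange _ _ _ _) (swap ⟨⊗⟩ idʳ _)) ⟨⨾⟩ cast-⨾ _ _ ⟩
  ⟨ rewire (v ∷ w ∷ []) , rewire φ ⟩ ⨾ (id [ y ] ⊗ σ [ x ] b)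
    ≈⟨ ⨾-congʳ (≈-sym (rewire-++ˢ (v ∷ w ∷ []) φ)) ⟩
  rewire (v ∷ w ∷ φ) ⨾ (id [ y ] ⊗ σ [ x ] b)
    ≈⟨ rewire-∷-⨾-id⊗ v (w ∷ φ) (σ [ x ] b) ⟩
  ⟨ pick v , rewire (w ∷ φ) ⨾ σ [ x ] b ⟩
    ≈⟨ ⨾-congˡ (≈-refl ⟨⊗⟩ rewire-∷-⨾-σ w φ) ⟩
  rewire (v ∷ (φ ++ˢ (w ∷ []))) ∎
  where
  open ≈-Reasoning
  swap : (rewire (w ∷ v ∷ []) ⨾ σ [ x ] [ y ]) ≈ rewire (v ∷ w ∷ [])
  swap = ≈-trans (⨾-congʳ (rewire-pair w v)) (≈-trans (pair-pick-comm w v) (≈-sym (rewire-pair v w)))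

rewire-++ˢ-⨾-σ : (φ : Selection c b) (ψ : Selection c d) → (rewire (φ ++ˢ ψ) ⨾ σ b d) ≈ rewire (ψ ++ˢ φ)
rewire-++ˢ-⨾-σ [] ψ = ≈-trans (⨾-≈id (σ-unitˡ _)) (≈-sym (rewire-++ˢ-[] ψ))
rewire-++ˢ-⨾-σ {c = c} {d = d} (_∷_ {x} {b} w φ) ψ = begin
  rewire (w ∷ (φ ++ˢ ψ)) ⨾ σ (x ∷ b) d
    ≈⟨ ⨾-congˡ (σ-hexʳ [ x ] b d) ⟩
  rewire (w ∷ (φ ++ˢ ψ)) ⨾ (cast (++-assoc [ x ] b d) ⨾ (id [ x ] ⊗ σ b d) ⨾
                          cast (sym (++-assoc [ x ] d b)) ⨾ (σ [ x ] d ⊗ id b))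
    ≈⟨ ≈-trans (⨾-congˡ (cast-⨾ _ _)) (≈-sym (⨾-assoc _ _ _)) ⟩
  (rewire (w ∷ (φ ++ˢ ψ)) ⨾ (id [ x ] ⊗ σ b d)) ⨾ (cast (sym (++-assoc [ x ] d b)) ⨾ (σ [ x ] d ⊗ id b))
    ≈⟨ ≈-trans (rewire-∷-⨾-id⊗ w (φ ++ˢ ψ) (σ b d))
         (≈-trans (⨾-congˡ (≈-refl ⟨⊗⟩ ≈-trans (rewire-++ˢ-⨾-σ φ ψ) (rewire-++ˢ ψ φ)))
                  (pair-assoc (pick w) (rewire ψ) (rewire φ)))
       ⟨⨾⟩ cast-⨾ _ _ ⟩
  ⟨ rewire (w ∷ ψ) , rewire φ ⟩ ⨾ (σ [ x ] d ⊗ id b)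
    ≈⟨ ≈-trans (⨾-assoc _ _ _) (⨾-congˡ (≈-trans (interchange _ _ _ _) (rewire-∷-⨾-σ w ψ ⟨⊗⟩ idʳ _))) ⟩
  ⟨ rewire (ψ ++ˢ (w ∷ [])) , rewire φ ⟩
    ≈⟨ ≈-trans (≈-sym (rewire-++ˢ (ψ ++ˢ (w ∷ [])) φ)) (rewire-++ˢ-assoc ψ (w ∷ []) φ) ⟩
  rewire (ψ ++ˢ (w ∷ φ)) ∎
  where open ≈-Reasoning

δs≈rewire : (c : List (Fin n)) → δs c ≈ rewire (idˢ c ++ˢ idˢ c)
δs≈rewire c = ≈-sym (≈-trans (rewire-++ˢ (idˢ c) (idˢ c))
  (≈-trans (⨾-congˡ (≈-trans (rewire-idˢ c ⟨⊗⟩ rewire-idˢ c) (⊗-id c c))) (idʳ _)))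

δs-comm : (c : List (Fin n)) → (δs c ⨾ σ c c) ≈ δs c
δs-comm c = ≈-trans (⨾-congʳ (δs≈rewire c)) (≈-trans (rewire-++ˢ-⨾-σ (idˢ c) (idˢ c)) (≈-sym (δs≈rewire c)))

pair-comm : (f : Tm c b) (g : Tm c d) → (⟨ f , g ⟩ ⨾ σ b d) ≈ ⟨ g , f ⟩
pair-comm {c = c} f g =
  ≈-trans (⨾-assoc _ _ _) (≈-trans (⨾-congˡ (σ-natural f g)) (≈-trans (≈-sym (⨾-assoc _ _ _)) (⨾-congʳ (δs-comm c))))

lookupˢ : ∀ {y} → Selection c b → Wire b y → Wire c y
lookupˢ (w ∷ θ) here      = w
lookupˢ (w ∷ θ) (there v) = lookupˢ θ v

infixr 9 _∘ˢ_
_∘ˢ_ : Selection c b → Selection b d → Selection c d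
θ ∘ˢ []      = []
θ ∘ˢ (v ∷ χ) = lookupˢ θ v ∷ (θ ∘ˢ χ)

rewire-⨾-εs : (θ : Selection c b) → (rewire θ ⨾ εs b) ≈ εs c
rewire-⨾-εs []      = idʳ _
rewire-⨾-εs {c = c} (w ∷ θ) =
  ≈-trans (⨾-assoc _ _ _)
  (≈-trans (⨾-congˡ (≈-trans (interchange _ _ _ _) (pick-⨾-ε w ⟨⊗⟩ rewire-⨾-εs θ))) (pair-discardˡ (εs c)))

rewire-⨾-pick : ∀ {y} (θ : Selection c b) (v : Wire b y) → (rewire θ ⨾ pick v) ≈ pick (lookupˢ θ v)
rewire-⨾-pick (w ∷ θ) here =
  ≈-trans (rewire-∷-⨾-id⊗ w θ _) (≈-trans (⨾-congˡ (≈-refl ⟨⊗⟩ rewire-⨾-εs θ)) (pair-discardʳ (pick w)))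
rewire-⨾-pick (w ∷ θ) (there v) =
  ≈-trans (⨾-assoc _ _ _)
  (≈-trans (⨾-congˡ (≈-trans (interchange _ _ _ _) (pick-⨾-ε w ⟨⊗⟩ rewire-⨾-pick θ v))) (pair-discardˡ _))

rewire-⨾-δs : (θ : Selection c b) → (rewire θ ⨾ δs b) ≈ ⟨ rewire θ , rewire θ ⟩
rewire-⨾-δs {c = c} []  = ≈-trans (idʳ _) (≈-sym (pair-discardˡ (εs c)))
rewire-⨾-δs {c = c} (_∷_ {y} {b} w θ) = begin
  rewire (w ∷ θ) ⨾ ((δ y ⊗ δs b) ⨾ (id [ y ] ⊗ shuffle))
    ≈⟨ ≈-trans (≈-sym (⨾-assoc _ _ _)) (⨾-congʳ (≈-trans (⨾-assoc _ _ _) (⨾-congˡ (≈-trans (interchange _ _ _ _)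
         (≈-trans (pick-⨾-δ w) (≈-sym (rewire-pair w w)) ⟨⊗⟩
          ≈-trans (rewire-⨾-δs θ) (≈-sym (rewire-++ˢ θ θ))))))) ⟩
  ⟨ rewire (w ∷ w ∷ []) , rewire (θ ++ˢ θ) ⟩ ⨾ (id [ y ] ⊗ shuffle)
    ≈⟨ ⨾-congʳ (≈-sym (rewire-++ˢ (w ∷ w ∷ []) (θ ++ˢ θ))) ⟩
  rewire (w ∷ w ∷ (θ ++ˢ θ)) ⨾ (id [ y ] ⊗ shuffle)
    ≈⟨ rewire-∷-⨾-id⊗ w (w ∷ (θ ++ˢ θ)) _ ⟩
  ⟨ pick w , rewire ((w ∷ θ) ++ˢ θ) ⨾ shuffle ⟩
    ≈⟨ ⨾-congˡ (≈-refl ⟨⊗⟩ shuffle-absorbed) ⟩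
  ⟨ pick w , rewire (θ ++ˢ (w ∷ θ)) ⟩
    ≈⟨ ⨾-congˡ (≈-refl ⟨⊗⟩ rewire-++ˢ θ (w ∷ θ)) ⟩
  ⟨ pick w , ⟨ rewire θ , rewire (w ∷ θ) ⟩ ⟩
    ≈⟨ pair-assoc _ _ _ ⟩
  ⟨ rewire (w ∷ θ) , rewire (w ∷ θ) ⟩ ∎
  where
  open ≈-Reasoning
  shuffle : Tm (y ∷ (b ++ b)) (b ++ (y ∷ b))
  shuffle = (σ [ y ] b ⊗ id b) ⨾ cast (++-assoc b [ y ] b)
  shuffle-absorbed : (rewire ((w ∷ θ) ++ˢ θ) ⨾ shuffle) ≈ rewire (θ ++ˢ (w ∷ θ))
  shuffle-absorbed =
    ≈-trans (⨾-congˡ (⨾-cast _ _))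
    (≈-trans (⨾-congʳ (rewire-++ˢ (w ∷ θ) θ))
    (≈-trans (⨾-assoc _ _ _)
    (≈-trans (⨾-congˡ (≈-trans (interchange _ _ _ _) (rewire-∷-⨾-σ w θ ⟨⊗⟩ idʳ _)))
    (≈-trans (≈-sym (rewire-++ˢ (θ ++ˢ (w ∷ [])) θ)) (rewire-++ˢ-assoc θ (w ∷ []) θ)))))

rewire-⨾-rewire : (θ : Selection c b) (χ : Selection b d) → (rewire θ ⨾ rewire χ) ≈ rewire (θ ∘ˢ χ)
rewire-⨾-rewire θ []      = rewire-⨾-εs θ
rewire-⨾-rewire θ (v ∷ χ) =
  ≈-trans (≈-sym (⨾-assoc _ _ _))
  (≈-trans (⨾-congʳ (rewire-⨾-δs θ))
  (≈-trans (⨾-assoc _ _ _)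
  (⨾-congˡ (≈-trans (interchange _ _ _ _) (rewire-⨾-pick θ v ⟨⊗⟩ rewire-⨾-rewire θ χ)))))

splitˢ : (b : List (Fin n)) (φ : Selection c (b ++ d)) →
         Σ (Selection c b) λ φ₁ → Σ (Selection c d) λ φ₂ → φ ≡ φ₁ ++ˢ φ₂
splitˢ []      φ       = [] , φ , refl
splitˢ (x ∷ b) (w ∷ φ) with splitˢ b φ
... | φ₁ , φ₂ , refl = w ∷ φ₁ , φ₂ , refl

rewire-++ˢ-⨾-⊗ : (φ : Selection c a) (ψ : Selection c a′) (f : Tm a b) (g : Tm a′ b′) →
                 (rewire (φ ++ˢ ψ) ⨾ (f ⊗ g)) ≈ ⟨ rewire φ ⨾ f , rewire ψ ⨾ g ⟩
rewire-++ˢ-⨾-⊗ φ ψ f g = ≈-trans (⨾-congʳ (rewire-++ˢ φ ψ)) (≈-trans (⨾-assoc _ _ _) (⨾-congˡ (interchange _ _ _ _)))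


selection-of : (∀ y → Wire a y) → (b : List (Fin n)) → Selection a b
selection-of wires []      = []
selection-of wires (y ∷ b) = wires y ∷ selection-of wires b

-- Normal forms

-- `run pr ⨾ rewire ψ` adds the boxes of `pr` one at a time, each fed by copies of wires already present
-- and with its output wire placed in front, and finally selects the outputs by ψ.
data Prog {n : ℕ} (c : List (Fin n)) : List (Fin n) → Set where
  done   : Prog c c
  addBox : ∀ {d} (v : Fin n) (P : Subset n) → Selection c (elems P) → Prog (v ∷ c) d → Prog c d

boxStep : (c : List (Fin n)) (v : Fin n) (P : Subset n) → Selection c (elems P) → Tm c (v ∷ c)
boxStep c v P χ = ⟨ rewire χ ⨾ box P v , id c ⟩

run : Prog c d → Tm c d
run {c = c} done              = id c
run {c = c} (addBox v P χ pr) = boxStep c v P χ ⨾ run pr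

indicator : Fin n → Fin n → ℕ
indicator v x = if does (v ≟ x) then 1 else 0

onlyAt : Fin n → Subset n → Fin n → Subset n
onlyAt v P y = if does (v ≟ y) then P else ⊥

boxCountᵖ : {c d : List (Fin n)} → Prog c d → Fin n → ℕ
boxCountᵖ done              x = 0
boxCountᵖ (addBox v P χ pr) x = indicator v x + boxCountᵖ pr x

parDᵖ : {c d : List (Fin n)} → Prog c d → Fin n → Subset n
parDᵖ done              y = ⊥
parDᵖ (addBox v P χ pr) y = onlyAt v P y ∪ parDᵖ pr y

infixr 5 _++ᵖ_
_++ᵖ_ : Prog c d → Prog d e → Prog c e
done            ++ᵖ pr′ = pr′
addBox v P χ pr ++ᵖ pr′ = addBox v P χ (pr ++ᵖ pr′)

run-++ᵖ : (pr : Prog c d) (pr′ : Prog d e) → run (pr ++ᵖ pr′) ≈ (run pr ⨾ run pr′)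
run-++ᵖ done              pr′ = ≈-sym (idˡ _)
run-++ᵖ (addBox v P χ pr) pr′ = ≈-trans (⨾-congˡ (run-++ᵖ pr pr′)) (≈-sym (⨾-assoc _ _ _))

earlierˢ : Prog c d → Selection d c
earlierˢ {c = c} done              = idˢ c
earlierˢ {c = c} (addBox v P χ pr) = earlierˢ pr ∘ˢ thereˢ (idˢ c)

pair-pull-boxStepˡ : (v : Fin n) (P : Subset n) (χ : Selection c (elems P)) (g : Tm (v ∷ c) e) (h : Tm c e′) →
  ⟨ boxStep c v P χ ⨾ g , h ⟩ ≈ (boxStep c v P χ ⨾ ⟨ g , rewire (thereˢ (idˢ c)) ⨾ h ⟩)
pair-pull-boxStepˡ {c = c} v P χ g h =
  ≈-trans (⨾-congˡ (≈-sym (≈-trans (interchange _ _ _ _) (≈-refl ⟨⊗⟩ idˡ h))))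
  (≈-trans (≈-sym (⨾-assoc _ _ _))
  (≈-trans (⨾-congʳ (≈-trans (≈-sym (pair-assoc B (id c) (id c)))
                              (⨾-congˡ (≈-refl ⟨⊗⟩ ≈-trans (⨾-congˡ (⊗-id c c)) (idʳ _)))))
  (≈-sym
  (≈-trans (⨾-congˡ (⨾-congˡ (≈-sym (≈-trans (interchange _ _ _ _) (idˡ g ⟨⊗⟩ ≈-refl)))))
  (≈-trans (⨾-congˡ (≈-trans (≈-sym (⨾-assoc _ _ _)) (⨾-congʳ keep-earlier)))
  (≈-trans (≈-sym (⨾-assoc _ _ _))
  (⨾-congʳ (≈-trans (⨾-assoc _ _ _) (⨾-congˡ (≈-trans (interchange _ _ _ _) (idʳ B ⟨⊗⟩ idˡ _)))))))))))
  where
  B : Tm c [ v ]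
  B = rewire χ ⨾ box P v
  keep-earlier : ⟨ id (v ∷ c) , rewire (thereˢ {z = v} (idˢ c)) ⟩ ≈ (id [ v ] ⊗ δs c)
  keep-earlier =
    ≈-trans (⨾-congˡ (≈-sym (⊗-id [ v ] c) ⟨⊗⟩ ≈-trans (rewire-thereˢ (idˢ c)) (≈-refl ⟨⊗⟩ rewire-idˢ c)))
    (≈-trans (δs-∷-interchange v c (id [ v ]) (id c) (ε v) (id c))
    (≈-trans ((δ-unitʳ v ⟨⊗⟩ ≈-trans (⨾-congˡ (⊗-id c c)) (idʳ _)) ⟨⨾⟩ middleFour-unitˡ [ v ] c c) (idʳ _)))

pair-pull-runˡ : (pr : Prog c d) (g : Tm d e) (h : Tm c e′) →
                 ⟨ run pr ⨾ g , h ⟩ ≈ (run pr ⨾ ⟨ g , rewire (earlierˢ pr) ⨾ h ⟩)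
pair-pull-runˡ {c = c} done g h =
  ≈-trans (⨾-congˡ (idˡ g ⟨⊗⟩ ≈-refl))
  (≈-sym (≈-trans (idˡ _) (⨾-congˡ (≈-refl ⟨⊗⟩ ≈-trans (⨾-congʳ (rewire-idˢ c)) (idˡ h)))))
pair-pull-runˡ {c = c} (addBox v P χ pr) g h =
  ≈-trans (⨾-congˡ (⨾-assoc _ _ _ ⟨⊗⟩ ≈-refl))
  (≈-trans (pair-pull-boxStepˡ v P χ (run pr ⨾ g) h)
  (≈-trans (⨾-congˡ (pair-pull-runˡ pr g _))
  (≈-trans (≈-sym (⨾-assoc _ _ _))
  (⨾-congˡ (⨾-congˡ (≈-refl ⟨⊗⟩
    ≈-trans (≈-sym (⨾-assoc _ _ _)) (⨾-congʳ (rewire-⨾-rewire (earlierˢ pr) (thereˢ (idˢ c))))))))))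

pair-pull-runʳ : (pr : Prog c d) (g : Tm c e) (h : Tm d e′) →
                 ⟨ g , run pr ⨾ h ⟩ ≈ (run pr ⨾ ⟨ rewire (earlierˢ pr) ⨾ g , h ⟩)
pair-pull-runʳ pr g h =
  ≈-trans (≈-sym (pair-comm (run pr ⨾ h) g))
  (≈-trans (⨾-congʳ (pair-pull-runˡ pr h g))
  (≈-trans (⨾-assoc _ _ _)
  (⨾-congˡ (pair-comm h _))))

rewire-⨾-boxStep : (θ : Selection c′ c) (v : Fin n) (P : Subset n) (χ : Selection c (elems P)) →
  (rewire θ ⨾ boxStep c v P χ) ≈ (boxStep c′ v P (θ ∘ˢ χ) ⨾ rewire (here ∷ thereˢ {z = v} θ))
rewire-⨾-boxStep θ v P χ =
  ≈-trans (≈-sym (⨾-assoc _ _ _))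
  (≈-trans (⨾-congʳ (rewire-⨾-δs θ))
  (≈-trans (⨾-assoc _ _ _)
  (≈-trans (⨾-congˡ (≈-trans (interchange _ _ _ _)
     (≈-trans (≈-sym (⨾-assoc _ _ _)) (⨾-congʳ (rewire-⨾-rewire θ χ)) ⟨⊗⟩ idʳ _)))
  (≈-trans (⨾-congˡ (≈-trans (≈-sym (idʳ _) ⟨⊗⟩ ≈-sym (idˡ _)) (≈-sym (interchange _ _ _ _))))
  (≈-trans (≈-sym (⨾-assoc _ _ _)) (⨾-congˡ (≈-sym (rewire-here∷thereˢ θ))))))))

record NormalForm {c b : List (Fin n)} (f : Tm c b) : Set where
  constructor normalForm
  field
    mid  : List (Fin n)
    prog : Prog c mid
    out  : Selection mid b
    f≈   : f ≈ (run prog ⨾ rewire out)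

rewire-⨾-run : (θ : Selection c′ c) (pr : Prog c d) → NormalForm (rewire θ ⨾ run pr)
rewire-⨾-run {c′ = c′} θ done = normalForm c′ done θ (≈-trans (idʳ _) (≈-sym (idˡ _)))
rewire-⨾-run θ (addBox v P χ pr) with rewire-⨾-run (here ∷ thereˢ {z = v} θ) pr
... | normalForm d′ pr′ θ′ e =
  normalForm d′ (addBox v P (θ ∘ˢ χ) pr′) θ′
    (≈-trans (≈-sym (⨾-assoc _ _ _))
    (≈-trans (⨾-congʳ (rewire-⨾-boxStep θ v P χ))
    (≈-trans (⨾-assoc _ _ _) (≈-trans (⨾-congˡ e) (≈-sym (⨾-assoc _ _ _))))))

boxFree-εs : (a : List (Fin n)) → BoxFree (εs a)
boxFree-εs []      = id []
boxFree-εs (x ∷ a) = ε x ⊗ boxFree-εs a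

boxFree-δs : (a : List (Fin n)) → BoxFree (δs a)
boxFree-δs []      = id []
boxFree-δs (x ∷ a) =
  (δ x ⊗ boxFree-δs a) ⨾ (id [ x ] ⊗ ((σ [ x ] a ⊗ id a) ⨾ boxFree-cast (++-assoc a [ x ] a)))

boxFree-pick : ∀ {y} (w : Wire a y) → BoxFree (pick w)
boxFree-pick (here {x} {a}) = id [ x ] ⊗ boxFree-εs a
boxFree-pick (there {x} w)  = ε x ⊗ boxFree-pick w

boxFree-rewire : (φ : Selection c b) → BoxFree (rewire φ)
boxFree-rewire {c = c} []      = boxFree-εs c
boxFree-rewire {c = c} (w ∷ φ) = boxFree-δs c ⨾ (boxFree-pick w ⊗ boxFree-rewire φ)

boxCount-run : (pr : Prog c d) → ∀ x → boxCount (run pr) x ≡ boxCountᵖ pr x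
boxCount-run done x = refl
boxCount-run {c = c} (addBox v P χ pr) x =
  cong₂ _+_ (trans (cong₂ _+_ (BoxFree⇒boxCount≡0 (boxFree-δs c) x)
                              (trans (cong (_+ 0) (cong (_+ indicator v x) (BoxFree⇒boxCount≡0 (boxFree-rewire χ) x)))
                                     (+-identityʳ _)))
                   refl)
            (boxCount-run pr x)

parD-run : (pr : Prog c d) → ∀ y → parD (run pr) y ≡ parDᵖ pr y
parD-run done y = refl
parD-run {c = c} (addBox v P χ pr) y =
  cong₂ _∪_ (trans (cong₂ _∪_ (BoxFree⇒parD≡⊥ (boxFree-δs c) y)
                              (trans (cong (_∪ ⊥) (cong (_∪ onlyAt v P y) (BoxFree⇒parD≡⊥ (boxFree-rewire χ) y)))
                                     (∪-identityʳ _)))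
                   (trans (∪-identityˡ _) (∪-identityˡ _)))
            (parD-run pr y)

boxCount-≈-normal : {f : Tm a b} (pr : Prog a d) (ψ : Selection d b) → f ≈ (run pr ⨾ rewire ψ) →
                    ∀ x → boxCount f x ≡ boxCountᵖ pr x
boxCount-≈-normal pr ψ e x =
  trans (boxCount-resp-≈ e x)
  (trans (cong₂ _+_ (boxCount-run pr x) (BoxFree⇒boxCount≡0 (boxFree-rewire ψ) x)) (+-identityʳ _))

parD-≈-normal : {f : Tm a b} (pr : Prog a d) (ψ : Selection d b) → f ≈ (run pr ⨾ rewire ψ) →
                ∀ y → parD f y ≡ parDᵖ pr y
parD-≈-normal pr ψ e y =
  trans (parD-resp-≈ e y)
  (trans (cong₂ _∪_ (parD-run pr y) (BoxFree⇒parD≡⊥ (boxFree-rewire ψ) y)) (∪-identityʳ _))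

run-⨾-normal : (pr : Prog c d) (pr′ : Prog d e) (ψ : Selection e b) → (run pr ⨾ (run pr′ ⨾ rewire ψ)) ≈ (run (pr ++ᵖ pr′) ⨾ rewire ψ)
run-⨾-normal pr pr′ ψ = ≈-trans (≈-sym (⨾-assoc _ _ _)) (⨾-congʳ (≈-sym (run-++ᵖ pr pr′)))

rewire≈normal : (φ : Selection c b) → rewire φ ≈ (run done ⨾ rewire φ)
rewire≈normal φ = ≈-sym (idˡ _)

normalise : (φ : Selection c a) (f : Tm a b) → NormalForm (rewire φ ⨾ f)
normalise {c = c} φ (id a) = normalForm c done φ (≈-trans (idʳ _) (rewire≈normal φ))
normalise φ (f ⨾ g) with normalise φ f
... | normalForm _ pr₁ ψ₁ e₁ with normalise ψ₁ g
... | normalForm d pr₂ ψ₂ e₂ =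
  normalForm d (pr₁ ++ᵖ pr₂) ψ₂
    (≈-trans (≈-sym (⨾-assoc _ _ _))
    (≈-trans (⨾-congʳ e₁)
    (≈-trans (⨾-assoc _ _ _) (≈-trans (⨾-congˡ e₂) (run-⨾-normal pr₁ pr₂ ψ₂)))))
normalise φ (_⊗_ {a₁} f g) with splitˢ a₁ φ
... | φ₁ , φ₂ , refl with normalise φ₁ f | normalise φ₂ g
... | normalForm _ pr₁ ψ₁ e₁ | normalForm _ pr₂ ψ₂ e₂ with rewire-⨾-run (earlierˢ pr₁) pr₂
... | normalForm d pr₂′ θ e = normalForm d (pr₁ ++ᵖ pr₂′) ((earlierˢ pr₂′ ∘ˢ ψ₁) ++ˢ (θ ∘ˢ ψ₂)) (begin
  rewire (φ₁ ++ˢ φ₂) ⨾ (f ⊗ g)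
    ≈⟨ rewire-++ˢ-⨾-⊗ φ₁ φ₂ f g ⟩
  ⟨ rewire φ₁ ⨾ f , rewire φ₂ ⨾ g ⟩
    ≈⟨ ⨾-congˡ (e₁ ⟨⊗⟩ e₂) ⟩
  ⟨ run pr₁ ⨾ rewire ψ₁ , run pr₂ ⨾ rewire ψ₂ ⟩
    ≈⟨ pair-pull-runˡ pr₁ (rewire ψ₁) (run pr₂ ⨾ rewire ψ₂) ⟩
  run pr₁ ⨾ ⟨ rewire ψ₁ , rewire (earlierˢ pr₁) ⨾ (run pr₂ ⨾ rewire ψ₂) ⟩
    ≈⟨ ⨾-congˡ (⨾-congˡ (≈-refl ⟨⊗⟩
         ≈-trans (≈-sym (⨾-assoc _ _ _)) (≈-trans (⨾-congʳ e) (⨾-assoc _ _ _)))) ⟩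
  run pr₁ ⨾ ⟨ rewire ψ₁ , run pr₂′ ⨾ (rewire θ ⨾ rewire ψ₂) ⟩
    ≈⟨ ⨾-congˡ (pair-pull-runʳ pr₂′ (rewire ψ₁) (rewire θ ⨾ rewire ψ₂)) ⟩
  run pr₁ ⨾ (run pr₂′ ⨾ ⟨ rewire (earlierˢ pr₂′) ⨾ rewire ψ₁ , rewire θ ⨾ rewire ψ₂ ⟩)
    ≈⟨ ⨾-congˡ (⨾-congˡ (≈-trans (⨾-congˡ (rewire-⨾-rewire (earlierˢ pr₂′) ψ₁ ⟨⊗⟩ rewire-⨾-rewire θ ψ₂))
                                 (≈-sym (rewire-++ˢ (earlierˢ pr₂′ ∘ˢ ψ₁) (θ ∘ˢ ψ₂))))) ⟩
  run pr₁ ⨾ (run pr₂′ ⨾ rewire ((earlierˢ pr₂′ ∘ˢ ψ₁) ++ˢ (θ ∘ˢ ψ₂)))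
    ≈⟨ run-⨾-normal pr₁ pr₂′ ((earlierˢ pr₂′ ∘ˢ ψ₁) ++ˢ (θ ∘ˢ ψ₂)) ⟩
  run (pr₁ ++ᵖ pr₂′) ⨾ rewire ((earlierˢ pr₂′ ∘ˢ ψ₁) ++ˢ (θ ∘ˢ ψ₂)) ∎)
  where open ≈-Reasoning
normalise {c = c} φ (σ a₁ a₂) with splitˢ a₁ φ
... | φ₁ , φ₂ , refl = normalForm c done (φ₂ ++ˢ φ₁) (≈-trans (rewire-++ˢ-⨾-σ φ₁ φ₂) (rewire≈normal (φ₂ ++ˢ φ₁)))
normalise {c = c} (w ∷ []) (δ x) =
  normalForm c done (w ∷ w ∷ [])
    (≈-trans (⨾-congʳ (rewire-single w))
    (≈-trans (pick-⨾-δ w) (≈-trans (≈-sym (rewire-pair w w)) (rewire≈normal (w ∷ w ∷ [])))))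
normalise {c = c} (w ∷ []) (ε x) =
  normalForm c done [] (≈-trans (⨾-congʳ (rewire-single w)) (≈-trans (pick-⨾-ε w) (rewire≈normal [])))
normalise {c = c} φ (box P x) =
  normalForm (x ∷ c) (addBox x P φ done) (here ∷ [])
    (≈-sym (≈-trans (⨾-congʳ (idʳ _))
           (≈-trans (⨾-congˡ (rewire-single here))
           (≈-trans (⨾-assoc _ _ _)
           (≈-trans (⨾-congˡ (≈-trans (interchange _ _ _ _) (idʳ _ ⟨⊗⟩ idˡ _)))
           (pair-discardʳ _))))))

-- Uniqueness of normal forms

boxStep-⨾-boxStep : (u v : Fin n) (P Q : Subset n) (χᵤ : Selection c (elems P)) (χᵥ : Selection c (elems Q)) →
  (boxStep c u P χᵤ ⨾ boxStep (u ∷ c) v Q (thereˢ χᵥ)) ≈ ⟨ ⟨ rewire χᵥ ⨾ box Q v , rewire χᵤ ⨾ box P u ⟩ , id c ⟩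
boxStep-⨾-boxStep {c = c} u v P Q χᵤ χᵥ =
  ≈-trans (⨾-congˡ second-step)
  (≈-trans (≈-sym (⨾-assoc _ _ _))
  (≈-trans (⨾-congʳ (≈-trans (⨾-assoc _ _ _) (⨾-congˡ (≈-trans (interchange _ _ _ _) (idʳ _ ⟨⊗⟩ idˡ _)))))
  (≈-trans (⨾-congʳ (pair-assoc Bᵤ Bᵥ (id c)))
  (≈-trans (⨾-assoc _ _ _)
  (⨾-congˡ (≈-trans (interchange _ _ _ _) (pair-comm Bᵤ Bᵥ ⟨⊗⟩ idʳ _)))))))
  where
  Bᵤ : Tm c [ u ]
  Bᵤ = rewire χᵤ ⨾ box P u
  Bᵥ : Tm c [ v ]
  Bᵥ = rewire χᵥ ⨾ box Q v
  second-step : boxStep (u ∷ c) v Q (thereˢ χᵥ) ≈ ((id [ u ] ⊗ boxStep c v Q χᵥ) ⨾ (σ [ u ] [ v ] ⊗ id c))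
  second-step =
    ≈-trans (⨾-congˡ (≈-trans (⨾-congʳ (rewire-thereˢ χᵥ))
                       (≈-trans (⨾-congˡ (≈-sym (⊗-unitˡ (box Q v))))
                       (≈-trans (interchange _ _ _ _) (idʳ _ ⟨⊗⟩ ≈-refl))) ⟨⊗⟩
                     ≈-sym (⊗-id [ u ] c)))
    (≈-trans (δs-∷-interchange u c (ε u) Bᵥ (id [ u ]) (id c))
    ((δ-unitˡ u ⟨⊗⟩ ≈-refl) ⟨⨾⟩ ≈-trans (middleFour≈ [] [ u ] [ v ] c) (⊗-unitˡ _)))

swapˢ : {u v : Fin n} (c : List (Fin n)) → Selection (u ∷ v ∷ c) (v ∷ u ∷ c)
swapˢ c = there here ∷ here ∷ thereˢ (thereˢ (idˢ c))

rewire-swapˢ : {u v : Fin n} (c : List (Fin n)) → rewire (swapˢ {u = u} {v} c) ≈ (σ [ u ] [ v ] ⊗ id c)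
rewire-swapˢ {u = u} {v} c =
  ≈-sym (≈-trans (≈-sym (idˡ _)) (≈-trans (⨾-congʳ (≈-sym (rewire-idˢ (u ∷ v ∷ c))))
  (≈-trans (rewire-++ˢ-⨾-⊗ (here ∷ there here ∷ []) (thereˢ (thereˢ (idˢ c))) (σ [ u ] [ v ]) (id c))
  (≈-trans (⨾-congˡ (rewire-++ˢ-⨾-σ (here ∷ []) (there here ∷ []) ⟨⊗⟩ idʳ _))
  (≈-sym (rewire-++ˢ (there here ∷ here ∷ []) (thereˢ (thereˢ (idˢ c)))))))))

boxStep-swap : (u v : Fin n) (P Q : Subset n) (χᵤ : Selection c (elems P)) (χᵥ : Selection c (elems Q)) →
  (boxStep c u P χᵤ ⨾ boxStep (u ∷ c) v Q (thereˢ χᵥ)) ≈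
  (boxStep c v Q χᵥ ⨾ (boxStep (v ∷ c) u P (thereˢ χᵤ) ⨾ rewire (swapˢ c)))
boxStep-swap {c = c} u v P Q χᵤ χᵥ =
  ≈-trans (boxStep-⨾-boxStep u v P Q χᵤ χᵥ)
  (≈-sym (≈-trans (≈-sym (⨾-assoc _ _ _))
  (≈-trans (boxStep-⨾-boxStep v u Q P χᵥ χᵤ ⟨⨾⟩ rewire-swapˢ c)
  (≈-trans (⨾-assoc _ _ _)
  (⨾-congˡ (≈-trans (interchange _ _ _ _) (pair-comm _ _ ⟨⊗⟩ idʳ _)))))))

indicator-refl : (x : Fin n) → indicator x x ≡ 1
indicator-refl x with x ≟ x
... | yes _  = refl
... | no x≢x = ⊥-elim (x≢x refl)

onlyAt-refl : (x : Fin n) (P : Subset n) → onlyAt x P x ≡ P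
onlyAt-refl x P with x ≟ x
... | yes _  = refl
... | no x≢x = ⊥-elim (x≢x refl)

onlyAt-≢ : {v y : Fin n} (P : Subset n) → v ≢ y → onlyAt v P y ≡ ⊥
onlyAt-≢ {v = v} {y} P v≢y with v ≟ y
... | yes v≡y = ⊥-elim (v≢y v≡y)
... | no _    = refl

occ : Fin n → List (Fin n) → ℕ
occ x []      = 0
occ x (y ∷ l) = indicator y x + occ x l

Distinct : List (Fin n) → Set
Distinct l = ∀ x → occ x l ≤ 1

wire⇒1≤occ : ∀ {y} → Wire a y → 1 ≤ occ y a
wire⇒1≤occ {y = y} here rewrite indicator-refl y = s≤s z≤n
wire⇒1≤occ {a = x ∷ a} {y} (there w) = ≤-trans (wire⇒1≤occ w) (m≤n+m _ (indicator x y))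

wire-unique : Distinct a → ∀ {y} (v w : Wire a y) → v ≡ w
wire-unique {a = x ∷ a} distinct here      here      = refl
wire-unique {a = x ∷ a} distinct here      (there w) = ⊥-elim (head-twice w (distinct x))
  where
  head-twice : Wire a x → ¬ (indicator x x + occ x a ≤ 1)
  head-twice w le rewrite indicator-refl x with ≤-trans (wire⇒1≤occ w) (s≤s⁻¹ le)
  ... | ()
wire-unique {a = x ∷ a} distinct (there v) here      = sym (wire-unique distinct here (there v))
wire-unique {a = x ∷ a} distinct (there v) (there w) =
  cong there (wire-unique (λ z → ≤-trans (m≤n+m (occ z a) (indicator x z)) (distinct z)) v w)

selection-unique : Distinct c → (φ ψ : Selection c b) → φ ≡ ψ
selection-unique distinct []      []      = refl
selection-unique distinct (v ∷ φ) (w ∷ ψ) = cong₂ _∷_ (wire-unique distinct v w) (selection-unique distinct φ ψ)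

occ-run : (pr : Prog c d) (x : Fin n) → occ x d ≡ boxCountᵖ pr x + occ x c
occ-run done x = refl
occ-run {c = c} (addBox v P χ pr) x =
  trans (occ-run pr x) (trans (sym (+-assoc (boxCountᵖ pr x) (indicator v x) (occ x c)))
    (cong (_+ occ x c) (+-comm (boxCountᵖ pr x) (indicator v x))))

distinct-input : (pr : Prog c d) → Distinct d → Distinct c
distinct-input {c = c} pr distinct x =
  ≤-trans (m≤n+m (occ x c) (boxCountᵖ pr x)) (≤-trans (≤-reflexive (sym (occ-run pr x))) (distinct x))

boxCountᵖ≡0⇒parDᵖ≡⊥ : (pr : Prog c d) (x : Fin n) → boxCountᵖ pr x ≡ 0 → parDᵖ pr x ≡ ⊥
boxCountᵖ≡0⇒parDᵖ≡⊥ done x _ = refl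
boxCountᵖ≡0⇒parDᵖ≡⊥ (addBox v P χ pr) x none with v ≟ x
... | no _ = trans (∪-identityˡ _) (boxCountᵖ≡0⇒parDᵖ≡⊥ pr x none)

boxCountᵖ-resp-≈ : (pr : Prog c d) (pr′ : Prog c d′) (θ : Selection d′ d) → run pr ≈ (run pr′ ⨾ rewire θ) →
                   ∀ x → boxCountᵖ pr x ≡ boxCountᵖ pr′ x
boxCountᵖ-resp-≈ pr pr′ θ e x = trans (sym (boxCount-run pr x)) (boxCount-≈-normal pr′ θ e x)

parDᵖ-resp-≈ : (pr : Prog c d) (pr′ : Prog c d′) (θ : Selection d′ d) → run pr ≈ (run pr′ ⨾ rewire θ) →
               ∀ y → parDᵖ pr y ≡ parDᵖ pr′ y
parDᵖ-resp-≈ pr pr′ θ e y = trans (sym (parD-run pr y)) (parD-≈-normal pr′ θ e y)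

record Front {c d : List (Fin n)} (pr : Prog c d) (v : Fin n) (Q : Subset n) (χ : Selection c (elems Q)) : Set where
  constructor front
  field
    mid  : List (Fin n)
    rest : Prog (v ∷ c) mid
    out  : Selection mid d
    run≈ : run pr ≈ (run (addBox v Q χ rest) ⨾ rewire out)

front-here : (v : Fin n) (P Q : Subset n) (χ : Selection c (elems P)) (χ′ : Selection c (elems Q))
             (pr : Prog (v ∷ c) d) → P ≡ Q → Distinct c → Front (addBox v P χ pr) v Q χ′
front-here {d = d} v P .P χ χ′ pr refl distinct rewrite selection-unique distinct χ χ′ =
  front d pr (idˢ d) (≈-sym (≈-trans (⨾-congˡ (rewire-idˢ d)) (idʳ _)))

bring-to-front : (pr : Prog c d) (v : Fin n) (Q : Subset n) (χ : Selection c (elems Q)) →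
                 Distinct d → boxCountᵖ pr v ≡ 1 → parDᵖ pr v ≡ Q → Front pr v Q χ
bring-to-front done v Q χ _ () _
bring-to-front {c = c} (addBox u P χᵤ pr) v Q χ distinct count parents with u ≟ v
... | yes refl = front-here u P Q χᵤ χ pr P≡Q (distinct-input (addBox u P χᵤ pr) distinct)
  where
  P≡Q : P ≡ Q
  P≡Q = trans (sym (∪-identityʳ P))
          (trans (cong (P ∪_) (sym (boxCountᵖ≡0⇒parDᵖ≡⊥ pr u (suc-injective count)))) parents)
... | no u≢v with bring-to-front pr v Q (thereˢ χ) distinct count (trans (sym (∪-identityˡ _)) parents)
... | front _ rest θ e with rewire-⨾-run (swapˢ {u = u} {v} c) rest
... | normalForm mid rest′ θ′ e′ = front mid (addBox u P (thereˢ χᵤ) rest′) (θ′ ∘ˢ θ) (begin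
  boxStep c u P χᵤ ⨾ run pr
    ≈⟨ ⨾-congˡ e ⟩
  boxStep c u P χᵤ ⨾ ((boxStep (u ∷ c) v Q (thereˢ χ) ⨾ run rest) ⨾ rewire θ)
    ≈⟨ ≈-trans (⨾-congˡ (⨾-assoc _ _ _)) (≈-sym (⨾-assoc _ _ _)) ⟩
  (boxStep c u P χᵤ ⨾ boxStep (u ∷ c) v Q (thereˢ χ)) ⨾ (run rest ⨾ rewire θ)
    ≈⟨ ⨾-congʳ (boxStep-swap u v P Q χᵤ χ) ⟩
  (boxStep c v Q χ ⨾ (boxStep (v ∷ c) u P (thereˢ χᵤ) ⨾ rewire (swapˢ c))) ⨾ (run rest ⨾ rewire θ)
    ≈⟨ ≈-trans (⨾-assoc _ _ _) (⨾-congˡ (≈-trans (⨾-assoc _ _ _) (⨾-congˡ (≈-sym (⨾-assoc _ _ _))))) ⟩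
  boxStep c v Q χ ⨾ (boxStep (v ∷ c) u P (thereˢ χᵤ) ⨾ ((rewire (swapˢ c) ⨾ run rest) ⨾ rewire θ))
    ≈⟨ ⨾-congˡ (⨾-congˡ (≈-trans (⨾-congʳ e′) (≈-trans (⨾-assoc _ _ _) (⨾-congˡ (rewire-⨾-rewire θ′ θ))))) ⟩
  boxStep c v Q χ ⨾ (boxStep (v ∷ c) u P (thereˢ χᵤ) ⨾ (run rest′ ⨾ rewire (θ′ ∘ˢ θ)))
    ≈⟨ ≈-trans (⨾-congˡ (≈-sym (⨾-assoc _ _ _))) (≈-sym (⨾-assoc _ _ _)) ⟩
  run (addBox v Q χ (addBox u P (thereˢ χᵤ) rest′)) ⨾ rewire (θ′ ∘ˢ θ) ∎)
  where open ≈-Reasoning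

distinct-resp-boxCountᵖ : (pr : Prog c d) (pr′ : Prog c d′) →
  (∀ x → boxCountᵖ pr x ≡ boxCountᵖ pr′ x) → Distinct d → Distinct d′
distinct-resp-boxCountᵖ {c = c} pr pr′ counts distinct x =
  subst (_≤ 1) (trans (occ-run pr x) (trans (cong (_+ occ x c) (counts x)) (sym (occ-run pr′ x)))) (distinct x)

private
  m+k≤1⇒m≡0 : ∀ m {k} → m + k ≤ 1 → 1 ≤ k → m ≡ 0
  m+k≤1⇒m≡0 zero    _        _   = refl
  m+k≤1⇒m≡0 (suc m) {k} (s≤s le) 1≤k with ≤-trans 1≤k (≤-trans (m≤n+m k m) le)
  ... | ()

no-box-for-wire : (pr : Prog c d) → Distinct d → ∀ {x} → Wire c x → boxCountᵖ pr x ≡ 0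
no-box-for-wire {c = c} pr distinct {x} w =
  m+k≤1⇒m≡0 (boxCountᵖ pr x) (subst (_≤ 1) (occ-run pr x) (distinct x)) (wire⇒1≤occ w)

normal-unique : (pr₁ : Prog c d₁) (pr₂ : Prog c d₂) (ψ₁ : Selection d₁ b) (ψ₂ : Selection d₂ b) →
  Distinct d₁ → Distinct d₂ → (∀ x → boxCountᵖ pr₁ x ≡ boxCountᵖ pr₂ x) → (∀ y → parDᵖ pr₁ y ≡ parDᵖ pr₂ y) →
  (run pr₁ ⨾ rewire ψ₁) ≈ (run pr₂ ⨾ rewire ψ₂)
normal-unique done done ψ₁ ψ₂ distinct₁ _ _ _ rewrite selection-unique distinct₁ ψ₁ ψ₂ = ≈-refl
normal-unique (addBox v P χ pr) done _ _ _ _ counts _ =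
  ⊥-elim (1+n≢0 (trans (cong (_+ boxCountᵖ pr v) (sym (indicator-refl v))) (counts v)))
normal-unique {c = c} pr₁ (addBox v Q χ pr₂) ψ₁ ψ₂ distinct₁ distinct₂ counts parents
  with no-box-for-wire pr₂ distinct₂ here
... | fresh with bring-to-front pr₁ v Q χ distinct₁
                   (trans (counts v) (cong₂ _+_ (indicator-refl v) fresh))
                   (trans (parents v) (trans (cong₂ _∪_ (onlyAt-refl v Q) (boxCountᵖ≡0⇒parDᵖ≡⊥ pr₂ v fresh))
                                             (∪-identityʳ Q)))
... | front mid rest θ e = begin
  run pr₁ ⨾ rewire ψ₁
    ≈⟨ ⨾-congʳ e ⟩
  ((boxStep c v Q χ ⨾ run rest) ⨾ rewire θ) ⨾ rewire ψ₁
    ≈⟨ ≈-trans (⨾-assoc _ _ _) (≈-trans (⨾-assoc _ _ _) (⨾-congˡ (⨾-congˡ (rewire-⨾-rewire θ ψ₁)))) ⟩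
  boxStep c v Q χ ⨾ (run rest ⨾ rewire (θ ∘ˢ ψ₁))
    ≈⟨ ⨾-congˡ (normal-unique rest pr₂ (θ ∘ˢ ψ₁) ψ₂
                 (distinct-resp-boxCountᵖ pr₁ (addBox v Q χ rest) counts-front distinct₁) distinct₂ counts′ parents′) ⟩
  boxStep c v Q χ ⨾ (run pr₂ ⨾ rewire ψ₂)
    ≈⟨ ≈-sym (⨾-assoc _ _ _) ⟩
  run (addBox v Q χ pr₂) ⨾ rewire ψ₂ ∎
  where
  open ≈-Reasoning
  counts-front : ∀ x → boxCountᵖ pr₁ x ≡ boxCountᵖ (addBox v Q χ rest) x
  counts-front = boxCountᵖ-resp-≈ pr₁ (addBox v Q χ rest) θ e
  counts′ : ∀ x → boxCountᵖ rest x ≡ boxCountᵖ pr₂ x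
  counts′ x = +-cancelˡ-≡ (indicator v x) _ _ (trans (sym (counts-front x)) (counts x))
  parents′ : ∀ y → parDᵖ rest y ≡ parDᵖ pr₂ y
  parents′ y with v ≟ y
  ... | yes refl = trans (boxCountᵖ≡0⇒parDᵖ≡⊥ rest v (trans (counts′ v) fresh)) (sym (boxCountᵖ≡0⇒parDᵖ≡⊥ pr₂ v fresh))
  ... | no v≢y   =
    trans (sym (∪-identityˡ _))
    (trans (cong (_∪ parDᵖ rest y) (sym (onlyAt-≢ Q v≢y)))
    (trans (sym (parDᵖ-resp-≈ pr₁ (addBox v Q χ rest) θ e y))
    (trans (parents y) (trans (cong (_∪ parDᵖ pr₂ y) (onlyAt-≢ Q v≢y)) (∪-identityˡ _)))))

wire-map-suc⁻ : ∀ {l : List (Fin n)} {y} → Wire (map suc l) y → Σ (Fin n) λ y′ → y ≡ suc y′ × Wire l y′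
wire-map-suc⁻ {l = x ∷ l} here      = x , refl , here
wire-map-suc⁻ {l = x ∷ l} (there w) with wire-map-suc⁻ w
... | y′ , refl , w′ = y′ , refl , there w′

wire-map-suc⁺ : ∀ {l : List (Fin n)} {y} → Wire l y → Wire (map suc l) (suc y)
wire-map-suc⁺ here      = here
wire-map-suc⁺ (there w) = there (wire-map-suc⁺ w)

elems-wire⇒∈ : (P : Subset n) {y : Fin n} → Wire (elems P) y → y ∈ P
elems-wire⇒∈ {suc n} (true  ∷ᵥ P) here = Vec.here
elems-wire⇒∈ {suc n} (true  ∷ᵥ P) (there w) with wire-map-suc⁻ w
... | y′ , refl , w′ = Vec.there (elems-wire⇒∈ P w′)
elems-wire⇒∈ {suc n} (false ∷ᵥ P) w with wire-map-suc⁻ w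
... | y′ , refl , w′ = Vec.there (elems-wire⇒∈ P w′)

∈⇒elems-wire : (P : Subset n) {y : Fin n} → y ∈ P → Wire (elems P) y
∈⇒elems-wire {suc n} (true  ∷ᵥ P) Vec.here      = here
∈⇒elems-wire {suc n} (true  ∷ᵥ P) (Vec.there y∈P) = there (wire-map-suc⁺ (∈⇒elems-wire P y∈P))
∈⇒elems-wire {suc n} (false ∷ᵥ P) (Vec.there y∈P) = wire-map-suc⁺ (∈⇒elems-wire P y∈P)

occ-map-suc : (x : Fin n) (l : List (Fin n)) → occ (suc x) (map suc l) ≡ occ x l
occ-map-suc x []      = refl
occ-map-suc x (y ∷ l) = cong (indicator y x +_) (occ-map-suc x l)

occ-zero-map-suc : (l : List (Fin n)) → occ zero (map suc l) ≡ 0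
occ-zero-map-suc []      = refl
occ-zero-map-suc (y ∷ l) = occ-zero-map-suc l

occ-elems : (I : Subset n) (x : Fin n) → occ x (elems I) ≡ inputCount I x
occ-elems {suc n} (true  ∷ᵥ I) zero    = cong suc (occ-zero-map-suc (elems I))
occ-elems {suc n} (true  ∷ᵥ I) (suc x) = trans (occ-map-suc x (elems I)) (occ-elems I x)
occ-elems {suc n} (false ∷ᵥ I) zero    = occ-zero-map-suc (elems I)
occ-elems {suc n} (false ∷ᵥ I) (suc x) = trans (occ-map-suc x (elems I)) (occ-elems I x)

distinct-elems : (I : Subset n) → Distinct (elems I)
distinct-elems I x with lookup I x | occ-elems I x
... | true  | e = ≤-reflexive e
... | false | e = ≤-trans (≤-reflexive e) z≤n

occ-++ : (x : Fin n) (l m : List (Fin n)) → occ x (l ++ m) ≡ occ x l + occ x m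
occ-++ x []      m = refl
occ-++ x (y ∷ l) m = trans (cong (indicator y x +_) (occ-++ x l m)) (sym (+-assoc (indicator y x) _ _))

1≤occ⇒wire : (l : List (Fin n)) → 1 ≤ occ v l → Wire l v
1≤occ⇒wire {v = v} (x ∷ l) h with x ≟ v
... | yes refl = here
... | no _     = there (1≤occ⇒wire l h)

memb⇒wire : (l : List (Fin n)) → memb v l ≡ true → Wire l v
memb⇒wire {v = v} (x ∷ l) e with x ≟ v
... | yes refl = here
... | no _     = there (memb⇒wire l e)

¬memb⇒occ≡0 : (l : List (Fin n)) → memb v l ≡ false → occ v l ≡ 0
¬memb⇒occ≡0 []      _ = refl
¬memb⇒occ≡0 {v = v} (x ∷ l) e with x ≟ v
... | no _ = ¬memb⇒occ≡0 l e

memb-∷ʳ : (x v : Fin n) (l : List (Fin n)) → memb x (l ++ [ v ]) ≡ (memb x l ∨ does (v ≟ x))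
memb-∷ʳ x v []      = ∨-identityʳ _
memb-∷ʳ x v (y ∷ l) with does (y ≟ x)
... | true  = refl
... | false = memb-∷ʳ x v l

all-memb⇒selection : (l ys : List (Fin n)) → all (λ p → memb p l) ys ≡ true → Selection l ys
all-memb⇒selection l []       _ = []
all-memb⇒selection l (y ∷ ys) e with memb y l in ey
... | true = memb⇒wire l ey ∷ all-memb⇒selection l ys e

all≡false⇒counterexample : (q : Fin n → Bool) (ys : List (Fin n)) → all q ys ≡ false →
                           Σ (Fin n) λ y → Wire ys y × q y ≡ false
all≡false⇒counterexample q (y ∷ ys) e with q y in eq
... | true  = let (z , w , e′) = all≡false⇒counterexample q ys e in z , there w , e′
... | false = y , here , eq

filterᵇ-head : (p : Fin n → Bool) (xs : List (Fin n)) {v : Fin n} {r : List (Fin n)} →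
               filterᵇ p xs ≡ v ∷ r → p v ≡ true
filterᵇ-head p (x ∷ xs) e with p x in px
filterᵇ-head p (x ∷ xs) refl | true  = px
filterᵇ-head p (x ∷ xs) e    | false = filterᵇ-head p xs e

filterᵇ-[] : (p : Fin n → Bool) (xs : List (Fin n)) → filterᵇ p xs ≡ [] → ∀ {x} → Wire xs x → p x ≡ false
filterᵇ-[] p (x ∷ xs) e here with p x in px
filterᵇ-[] p (x ∷ xs) () here | true
... | false = refl
filterᵇ-[] p (y ∷ xs) e (there w) with p y
filterᵇ-[] p (y ∷ xs) () (there w) | true
... | false = filterᵇ-[] p xs e w

tabulate-wire : ∀ {m} (f : Fin m → Fin n) (i : Fin m) → Wire (tabulate f) (f i)
tabulate-wire f zero    = here
tabulate-wire f (suc i) = there (tabulate-wire (λ j → f (suc j)) i)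

allFin-wire : (x : Fin n) → Wire (allFin n) x
allFin-wire x = tabulate-wire (λ i → i) x

ParentsAvailable : (par : Fin n → Subset n) (cur vs : List (Fin n)) → Set
ParentsAvailable par cur []       = ⊤
ParentsAvailable par cur (v ∷ vs) = Selection cur (elems (par v)) × ParentsAvailable par (cur ++ [ v ]) vs

parentsAlong : (Fin n → Subset n) → List (Fin n) → Fin n → Subset n
parentsAlong par []       y = ⊥
parentsAlong par (v ∷ vs) y = onlyAt v (par v) y ∪ parentsAlong par vs y

unplaced : List (Fin n) → List (Fin n) → ℕ
unplaced pl []       = 0
unplaced pl (x ∷ xs) = (if memb x pl then 0 else 1) + unplaced pl xs

unplaced≤length : (pl xs : List (Fin n)) → unplaced pl xs ≤ length xs
unplaced≤length pl []       = z≤n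
unplaced≤length pl (x ∷ xs) with memb x pl
... | true  = ≤-trans (unplaced≤length pl xs) (n≤1+n _)
... | false = s≤s (unplaced≤length pl xs)

unplaced≡0⇒memb : (pl xs : List (Fin n)) → unplaced pl xs ≡ 0 → ∀ {x} → Wire xs x → memb x pl ≡ true
unplaced≡0⇒memb pl (x ∷ xs) e here with memb x pl
... | true = refl
unplaced≡0⇒memb pl (y ∷ xs) e (there w) with memb y pl
... | true = unplaced≡0⇒memb pl xs e w

unplaced-∷ʳ : (pl : List (Fin n)) (v : Fin n) (xs : List (Fin n)) → memb v pl ≡ false →
              unplaced (pl ++ [ v ]) xs + occ v xs ≡ unplaced pl xs
unplaced-∷ʳ pl v []       _      = refl
unplaced-∷ʳ pl v (x ∷ xs) v∉pl =
  trans (+-Properties.interchange A (unplaced (pl ++ [ v ]) xs) (indicator x v) (occ v xs))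
        (cong₂ _+_ head (unplaced-∷ʳ pl v xs v∉pl))
  where
  A : ℕ
  A = if memb x (pl ++ [ v ]) then 0 else 1
  head : A + indicator x v ≡ (if memb x pl then 0 else 1)
  head rewrite memb-∷ʳ x v pl with x ≟ v
  ... | yes refl rewrite v∉pl | dec-true (x ≟ x) refl = refl
  ... | no x≢v rewrite dec-false (v ≟ x) (λ v≡x → x≢v (sym v≡x)) | ∨-identityʳ (memb x pl) = +-identityʳ _

firstReady-just : (par : Fin n → Subset n) (pl : List (Fin n)) → firstReady par pl ≡ just v → ready par pl v ≡ true
firstReady-just {n} par pl e with filterᵇ (ready par pl) (allFin n) in ef
firstReady-just {n} par pl refl | v ∷ _ = filterᵇ-head (ready par pl) (allFin n) ef

firstReady-nothing : (par : Fin n → Subset n) (pl : List (Fin n)) → firstReady par pl ≡ nothing →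
                     ∀ x → ready par pl x ≡ false
firstReady-nothing {n} par pl e x with filterᵇ (ready par pl) (allFin n) in ef
firstReady-nothing {n} par pl refl x | [] = filterᵇ-[] (ready par pl) (allFin n) ef (allFin-wire x)

private
  not-b∧c≡true⇒b≡false : (b c : Bool) → (not b ∧ c) ≡ true → b ≡ false
  not-b∧c≡true⇒b≡false false c _ = refl

  b∧c≡true⇒c≡true : (b c : Bool) → (b ∧ c) ≡ true → c ≡ true
  b∧c≡true⇒c≡true true c e = e

  -- Following unplaced parents from an unplaced vertex n + 1 times must revisit a vertex.
  module Descent (par : Fin n → Subset n) (acyclic : ∀ x → ¬ Path par x x) (pl : List (Fin n))
                 (none-ready : ∀ x → ready par pl x ≡ false) where

    unplaced-parent : (x : Fin n) → memb x pl ≡ false → Σ (Fin n) λ y → y ∈ par x × memb y pl ≡ false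
    unplaced-parent x x∉pl
      with all≡false⇒counterexample (λ p → memb p pl) (elems (par x))
             (subst (λ b → (not b ∧ all (λ p → memb p pl) (elems (par x))) ≡ false) x∉pl (none-ready x))
    ... | y , w , y∉pl = y , elems-wire⇒∈ (par x) w , y∉pl

    descent : (u : Fin n) → memb u pl ≡ false → ℕ → Σ (Fin n) λ x → memb x pl ≡ false
    descent u u∉pl zero    = u , u∉pl
    descent u u∉pl (suc k) = let (x , x∉pl) = descent u u∉pl k
                                 (y , _ , y∉pl) = unplaced-parent x x∉pl
                             in y , y∉pl

    descent-path : (u : Fin n) (u∉pl : memb u pl ≡ false) (m k : ℕ) →
                   Path par (proj₁ (descent u u∉pl (suc m + k))) (proj₁ (descent u u∉pl k))
    descent-path u u∉pl zero    k = edge (proj₁ (proj₂ (unplaced-parent _ (proj₂ (descent u u∉pl k)))))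
    descent-path u u∉pl (suc m) k =
      proj₁ (proj₂ (unplaced-parent _ (proj₂ (descent u u∉pl (suc m + k))))) ◂ descent-path u u∉pl m k

    all-placed : ∀ x → memb x pl ≡ true
    all-placed x with memb x pl in ex
    ... | true  = refl
    ... | false with pigeonhole (n<1+n n) (λ (i : Fin (suc n)) → proj₁ (descent x ex (toℕ i)))
    ... | i , j , i<j , same with m≤n⇒∃[o]m+o≡n i<j
    ... | o , eo = ⊥-elim (acyclic _ (subst (λ z → Path par z (proj₁ (descent x ex (toℕ i))))
                                             (trans (cong (λ k → proj₁ (descent x ex k)) j≡) (sym same))
                                             (descent-path x ex o (toℕ i))))
      where
      j≡ : suc o + toℕ i ≡ toℕ j
      j≡ = trans (cong suc (+-comm o (toℕ i))) eo

placed-once : (pl : List (Fin n)) → (∀ x → memb x pl ≡ true) → Distinct pl → ∀ x → occ x pl ≡ 1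
placed-once pl placed distinct x = ≤-antisym (distinct x) (wire⇒1≤occ (memb⇒wire pl (placed x)))

-- Each step places a vertex not placed before, lowering `unplaced` by at least one, so the fuel
-- suffices to place every vertex.
topoFrom-once : (par : Fin n → Subset n) → (∀ x → ¬ Path par x x) → (k : ℕ) (pl : List (Fin n)) →
                Distinct pl → unplaced pl (allFin n) ≤ k → ∀ x → occ x (topoFrom par k pl) + occ x pl ≡ 1
topoFrom-once {n} par acyclic zero pl distinct fuel x =
  placed-once pl (λ y → unplaced≡0⇒memb pl (allFin n) (n≤0⇒n≡0 fuel) (allFin-wire y)) distinct x
topoFrom-once {n} par acyclic (suc k) pl distinct fuel x with firstReady par pl in e
... | nothing = placed-once pl (Descent.all-placed par acyclic pl (firstReady-nothing par pl e)) distinct x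
... | just v  = trans shift (topoFrom-once par acyclic k (pl ++ [ v ]) distinct′ fuel′ x)
  where
  rest : List (Fin n)
  rest = topoFrom par k (pl ++ [ v ])
  v∉pl : memb v pl ≡ false
  v∉pl = not-b∧c≡true⇒b≡false (memb v pl) _ (firstReady-just par pl e)
  distinct′ : Distinct (pl ++ [ v ])
  distinct′ y rewrite occ-++ y pl [ v ] with v ≟ y
  ... | yes refl rewrite ¬memb⇒occ≡0 pl v∉pl = ≤-refl
  ... | no _     = ≤-trans (≤-reflexive (+-identityʳ _)) (distinct y)
  fuel′ : unplaced (pl ++ [ v ]) (allFin n) ≤ k
  fuel′ = s≤s⁻¹ (≤-trans (≤-trans (≤-reflexive (+-comm 1 _))
                                   (+-monoʳ-≤ (unplaced (pl ++ [ v ]) (allFin n)) (wire⇒1≤occ (allFin-wire v))))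
                         (≤-trans (≤-reflexive (unplaced-∷ʳ pl v (allFin n) v∉pl)) fuel))
  shift : (indicator v x + occ x rest) + occ x pl ≡ occ x rest + occ x (pl ++ [ v ])
  shift rewrite occ-++ x pl [ v ] | +-identityʳ (indicator v x) =
    trans (cong (_+ occ x pl) (+-comm (indicator v x) (occ x rest)))
    (trans (+-assoc (occ x rest) (indicator v x) (occ x pl)) (cong (occ x rest +_) (+-comm (indicator v x) (occ x pl))))

topoFrom-available : (par : Fin n → Subset n) (k : ℕ) (pl : List (Fin n)) → ParentsAvailable par pl (topoFrom par k pl)
topoFrom-available par zero    pl = tt
topoFrom-available par (suc k) pl with firstReady par pl in e
... | nothing = tt
... | just v  = all-memb⇒selection pl (elems (par v)) (b∧c≡true⇒c≡true (not (memb v pl)) _ (firstReady-just par pl e))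
              , topoFrom-available par k (pl ++ [ v ])

occ-after : (x : Fin n) (cur vs : List (Fin n)) → occ x (after cur vs) ≡ occ x cur + occ x vs
occ-after x cur []       = sym (+-identityʳ _)
occ-after x cur (v ∷ vs) =
  trans (occ-after x (cur ++ [ v ]) vs)
  (trans (cong (_+ occ x vs) (trans (occ-++ x cur [ v ]) (cong (occ x cur +_) (+-identityʳ (indicator v x)))))
  (+-assoc (occ x cur) (indicator v x) (occ x vs)))

parentsAlong-absent : (par : Fin n → Subset n) (vs : List (Fin n)) (y : Fin n) → occ y vs ≡ 0 → parentsAlong par vs y ≡ ⊥
parentsAlong-absent par []       y _ = refl
parentsAlong-absent par (v ∷ vs) y e with v ≟ y
... | no _ = trans (∪-identityˡ _) (parentsAlong-absent par vs y e)

parentsAlong-once : (par : Fin n → Subset n) (vs : List (Fin n)) (y : Fin n) → occ y vs ≡ 1 → parentsAlong par vs y ≡ par y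
parentsAlong-once par (v ∷ vs) y e with v ≟ y
... | yes refl = trans (cong (par v ∪_) (parentsAlong-absent par vs v (suc-injective e))) (∪-identityʳ _)
... | no _     = trans (∪-identityˡ _) (parentsAlong-once par vs y e)

-- The open DAG of a network diagram

-- The position of the box labelled y in the program, counting from 1; 0 if there is none.
boxIndex : {c d : List (Fin n)} → Prog c d → Fin n → ℕ
boxIndex done              y = 0
boxIndex (addBox v P χ pr) y with v ≟ y | boxCountᵖ pr y
... | yes _ | _     = 1
... | no _  | zero  = 0
... | no _  | suc _ = suc (boxIndex pr y)

module _ {P : Subset n} {χ : Selection c (elems P)} {pr : Prog (v ∷ c) d} where

  boxIndex-input : v ≢ y → boxCountᵖ pr y ≡ 0 → boxIndex (addBox v P χ pr) y ≡ 0
  boxIndex-input {y = y} v≢y none with v ≟ y | boxCountᵖ pr y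
  ... | yes v≡y | _    = ⊥-elim (v≢y v≡y)
  ... | no _    | zero = refl

  boxIndex-later : v ≢ y → 1 ≤ boxCountᵖ pr y → boxIndex (addBox v P χ pr) y ≡ suc (boxIndex pr y)
  boxIndex-later {y = y} v≢y some with v ≟ y | boxCountᵖ pr y
  ... | yes v≡y | _     = ⊥-elim (v≢y v≡y)
  ... | no _    | suc _ = refl

1≤boxCountᵖ⇒1≤boxIndex : (pr : Prog c d) (y : Fin n) → 1 ≤ boxCountᵖ pr y → 1 ≤ boxIndex pr y
1≤boxCountᵖ⇒1≤boxIndex (addBox v P χ pr) y some with v ≟ y | boxCountᵖ pr y
... | yes _ | _     = ≤-refl
... | no _  | suc _ = s≤s z≤n

∈parDᵖ⇒1≤boxCountᵖ : (pr : Prog c d) → x ∈ parDᵖ pr y → 1 ≤ boxCountᵖ pr y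
∈parDᵖ⇒1≤boxCountᵖ {y = y} pr x∈ with boxCountᵖ pr y in none
... | suc _ = s≤s z≤n
... | zero  = ⊥-elim (∉⊥ (subst (_ ∈_) (boxCountᵖ≡0⇒parDᵖ≡⊥ pr y none) x∈))

boxIndex-increasing : (pr : Prog c d) → Distinct d → x ∈ parDᵖ pr y → boxIndex pr x < boxIndex pr y
boxIndex-increasing done _ x∈ = ⊥-elim (∉⊥ x∈)
boxIndex-increasing {c = c} {x = x} {y = y} (addBox v P χ pr) distinct x∈
  with x∈p∪q⁻ (onlyAt v P y) (parDᵖ pr y) x∈
... | inj₂ x∈pr = subst (boxIndex (addBox v P χ pr) x <_) (sym (boxIndex-later {χ = χ} {pr = pr} v≢y some)) x-before
  where
  some : 1 ≤ boxCountᵖ pr y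
  some = ∈parDᵖ⇒1≤boxCountᵖ pr x∈pr
  v≢y : v ≢ y
  v≢y refl with ≤-trans some (≤-reflexive (no-box-for-wire pr distinct here))
  ... | ()
  x-before : boxIndex (addBox v P χ pr) x < suc (boxIndex pr y)
  x-before with v ≟ x | boxCountᵖ pr x
  ... | yes refl | _     = s≤s (1≤boxCountᵖ⇒1≤boxIndex pr y some)
  ... | no _     | zero  = s≤s z≤n
  ... | no _     | suc _ = s≤s (boxIndex-increasing pr distinct x∈pr)
... | inj₁ x∈onlyAt with v ≟ y
...   | no _     = ⊥-elim (∉⊥ x∈onlyAt)
...   | yes refl = subst (_< 1) (sym (boxIndex-input {χ = χ} {pr = pr} v≢x (no-box-for-wire pr distinct (there w)))) ≤-refl
  where
  w : Wire c x
  w = lookupˢ χ (∈⇒elems-wire P x∈onlyAt)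
  v≢x : v ≢ x
  v≢x refl with wire-unique (distinct-input pr distinct) here (there w)
  ... | ()

boxIndex-path : (pr : Prog c d) → Distinct d → Path (parDᵖ pr) x y → boxIndex pr x < boxIndex pr y
boxIndex-path pr distinct (edge x∈)    = boxIndex-increasing pr distinct x∈
boxIndex-path pr distinct (x∈ ◂ path) = <-trans (boxIndex-increasing pr distinct x∈) (boxIndex-path pr distinct path)

Path-resp-≗ : {par par′ : Fin n → Subset n} → (∀ y → par y ≡ par′ y) → Path par x y → Path par′ x y
Path-resp-≗ {x = x} same (edge {y = y} x∈)    = edge (subst (x ∈_) (same y) x∈)
Path-resp-≗ {x = x} same (_◂_ {y = y} x∈ path) = subst (x ∈_) (same y) x∈ ◂ Path-resp-≗ same path

IsNetworkᵖ : (I : Subset n) → Prog (elems I) d → Set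
IsNetworkᵖ {n} I pr = (x : Fin n) → boxCountᵖ pr x + inputCount I x ≡ 1

network-distinct : (I : Subset n) (pr : Prog (elems I) d) → IsNetworkᵖ I pr → Distinct d
network-distinct I pr net x =
  ≤-reflexive (trans (occ-run pr x) (trans (cong (boxCountᵖ pr x +_) (occ-elems I x)) (net x)))

normal-form : (f : Tm a b) → NormalForm f
normal-form {a = a} f with normalise (idˢ a) f
... | normalForm d pr ψ e = normalForm d pr ψ (≈-trans (≈-sym (≈-trans (⨾-congʳ (rewire-idˢ a)) (idˡ f))) e)

IsNetwork⇒IsNetworkᵖ : {I O : Subset n} {D : Tm (elems I) (elems O)} (pr : Prog (elems I) d) (ψ : Selection d (elems O)) →
                       D ≈ (run pr ⨾ rewire ψ) → IsNetwork I D → IsNetworkᵖ I pr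
IsNetwork⇒IsNetworkᵖ {I = I} pr ψ e net x = trans (cong (_+ inputCount I x) (sym (boxCount-≈-normal pr ψ e x))) (net x)

IsNetwork-resp-≈ : {I O : Subset n} {D D′ : Tm (elems I) (elems O)} → D ≈ D′ → IsNetwork I D → IsNetwork I D′
IsNetwork-resp-≈ {I = I} e net x = trans (cong (_+ inputCount I x) (sym (boxCount-resp-≈ e x))) (net x)

network⇒openDAG : {I O : Subset n} (D : Tm (elems I) (elems O)) → IsNetwork I D → IsOpenDAG (parD D) I
network⇒openDAG {I = I} D net with normal-form D
... | normalForm d pr ψ e = record
  { acyclic     = λ x path → <-irrefl refl (boxIndex-path pr distinct (Path-resp-≗ (parD-≈-normal pr ψ e) path))
  ; inputs-root = λ i i∈I →
      trans (parD-≈-normal pr ψ e i) (boxCountᵖ≡0⇒parDᵖ≡⊥ pr i (no-box-for-wire pr distinct (∈⇒elems-wire I i∈I)))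
  }
  where
  distinct : Distinct d
  distinct = network-distinct I pr (IsNetwork⇒IsNetworkᵖ pr ψ e net)

network-unique : {I O : Subset n} (D D′ : Tm (elems I) (elems O)) → IsNetwork I D → IsNetwork I D′ →
                 (∀ y → parD D y ≡ parD D′ y) → D ≈ D′
network-unique {I = I} D D′ net net′ same with normal-form D | normal-form D′
... | normalForm _ pr ψ e | normalForm _ pr′ ψ′ e′ =
  ≈-trans e (≈-trans (normal-unique pr pr′ ψ ψ′ (network-distinct I pr netᵖ) (network-distinct I pr′ netᵖ′) counts parents)
                     (≈-sym e′))
  where
  netᵖ : IsNetworkᵖ I pr
  netᵖ = IsNetwork⇒IsNetworkᵖ pr ψ e net
  netᵖ′ : IsNetworkᵖ I pr′
  netᵖ′ = IsNetwork⇒IsNetworkᵖ pr′ ψ′ e′ net′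
  counts : ∀ x → boxCountᵖ pr x ≡ boxCountᵖ pr′ x
  counts x = +-cancelʳ-≡ (inputCount I x) _ _ (trans (netᵖ x) (sym (netᵖ′ x)))
  parents : ∀ y → parDᵖ pr y ≡ parDᵖ pr′ y
  parents y = trans (sym (parD-≈-normal pr ψ e y)) (trans (same y) (parD-≈-normal pr′ ψ′ e′ y))

-- The network diagram of an open DAG

proj-normal : (y : Fin n) (a : List (Fin n)) → Wire a y → Σ (Wire a y) λ w → proj y a ≈ pick w
proj-normal y (x ∷ a) w with x ≟ y
proj-normal y (x ∷ a) w         | yes refl = here , ≈-refl
proj-normal y (x ∷ a) here      | no x≢y   = ⊥-elim (x≢y refl)
proj-normal y (x ∷ a) (there w) | no _     with proj-normal y a w
... | w′ , e = there w′ , (≈-refl ⟨⊗⟩ e)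

sel-normal : (a b : List (Fin n)) → Selection a b → Σ (Selection a b) λ φ → sel a b ≈ rewire φ
sel-normal a []      []      = [] , ≈-refl
sel-normal a (y ∷ b) (w ∷ φ) with proj-normal y a w | sel-normal a b φ
... | w′ , e | φ′ , e′ = w′ ∷ φ′ , ⨾-congˡ (e ⟨⊗⟩ e′)

step≈boxStep : (cur : List (Fin n)) (v : Fin n) (P : Subset n) (χ : Selection cur (elems P)) →
               sel cur (elems P) ≈ rewire χ → step cur v P ≈ (boxStep cur v P χ ⨾ σ [ v ] cur)
step≈boxStep cur v P χ e =
  ≈-trans (⨾-congˡ (≈-refl ⟨⊗⟩ ⨾-congʳ e))
  (≈-sym (pair-comm (rewire χ ⨾ box P v) (id cur)))

record BuildNormalForm (par : Fin n → Subset n) (cur vs : List (Fin n)) {c′ : List (Fin n)}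
                       (θ : Selection c′ cur) : Set where
  constructor buildNormalForm
  field
    normal  : NormalForm (rewire θ ⨾ build par cur vs)
    counts  : ∀ x → boxCountᵖ (NormalForm.prog normal) x ≡ occ x vs
    parents : ∀ y → parDᵖ (NormalForm.prog normal) y ≡ parentsAlong par vs y

build-normal : (par : Fin n → Subset n) (cur vs : List (Fin n)) (θ : Selection c′ cur) →
               ParentsAvailable par cur vs → BuildNormalForm par cur vs θ
build-normal {c′ = c′} par cur [] θ _ =
  buildNormalForm (normalForm c′ done θ (≈-trans (idʳ _) (rewire≈normal θ))) (λ _ → refl) (λ _ → refl)
build-normal par cur (v ∷ vs) θ (available , rest) with sel-normal cur (elems (par v)) available
... | χ , sel≈ with build-normal par (cur ++ [ v ]) vs (thereˢ θ ++ˢ (here ∷ [])) rest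
... | buildNormalForm (normalForm d pr θ′ e) counts parents =
  buildNormalForm
    (normalForm d (addBox v (par v) (θ ∘ˢ χ) pr) θ′ (begin
      rewire θ ⨾ (step cur v (par v) ⨾ build par (cur ++ [ v ]) vs)
        ≈⟨ ≈-sym (⨾-assoc _ _ _) ⟩
      (rewire θ ⨾ step cur v (par v)) ⨾ build par (cur ++ [ v ]) vs
        ≈⟨ ⨾-congʳ (≈-trans (⨾-congˡ (step≈boxStep cur v (par v) χ sel≈)) (≈-sym (⨾-assoc _ _ _))) ⟩
      ((rewire θ ⨾ boxStep cur v (par v) χ) ⨾ σ [ v ] cur) ⨾ build par (cur ++ [ v ]) vs
        ≈⟨ ⨾-congʳ (≈-trans (⨾-congʳ (rewire-⨾-boxStep θ v (par v) χ))
                   (≈-trans (⨾-assoc _ _ _) (⨾-congˡ (rewire-∷-⨾-σ here (thereˢ θ))))) ⟩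
      (boxStep _ v (par v) (θ ∘ˢ χ) ⨾ rewire (thereˢ θ ++ˢ (here ∷ []))) ⨾ build par (cur ++ [ v ]) vs
        ≈⟨ ≈-trans (⨾-assoc _ _ _) (⨾-congˡ e) ⟩
      boxStep _ v (par v) (θ ∘ˢ χ) ⨾ (run pr ⨾ rewire θ′)
        ≈⟨ ≈-sym (⨾-assoc _ _ _) ⟩
      run (addBox v (par v) (θ ∘ˢ χ) pr) ⨾ rewire θ′ ∎))
    (λ x → cong (indicator v x +_) (counts x))
    (λ y → cong (onlyAt v (par v) y ∪_) (parents y))
  where open ≈-Reasoning

module _ {n} (par : Fin n → Subset n) (I O : Subset n) (dag : IsOpenDAG par I) where

  private
    order : List (Fin n)
    order = topo par I

    scheduled-once : ∀ x → occ x order + inputCount I x ≡ 1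
    scheduled-once x =
      trans (cong (occ x order +_) (sym (occ-elems I x)))
        (topoFrom-once par (IsOpenDAG.acyclic dag) n (elems I) (distinct-elems I)
          (≤-trans (unplaced≤length (elems I) (allFin n)) (≤-reflexive (length-tabulate (λ i → i)))) x)

    every-wire : ∀ y → Wire (after (elems I) order) y
    every-wire y = 1≤occ⇒wire _ (≤-reflexive (sym (trans (occ-after y (elems I) order)
      (trans (+-comm (occ y (elems I)) _) (trans (cong (occ y order +_) (occ-elems I y)) (scheduled-once y))))))

    built : BuildNormalForm par (elems I) order (idˢ (elems I))
    built = build-normal par (elems I) order (idˢ (elems I)) (topoFrom-available par n (elems I))
    open BuildNormalForm built
    open NormalForm normal

    outputs : Σ (Selection (after (elems I) order) (elems O)) λ φ → sel (after (elems I) order) (elems O) ≈ rewire φ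
    outputs = sel-normal (after (elems I) order) (elems O) (selection-of every-wire (elems O))

    DG≈ : DG par I O ≈ (run prog ⨾ rewire (out ∘ˢ proj₁ outputs))
    DG≈ =
      ≈-trans (≈-sym (idˡ _) ⟨⨾⟩ proj₂ outputs)
      (≈-trans (⨾-congʳ (≈-trans (⨾-congʳ (≈-sym (rewire-idˢ (elems I)))) f≈))
      (≈-trans (⨾-assoc _ _ _) (⨾-congˡ (rewire-⨾-rewire out (proj₁ outputs)))))

    parents-prog : ∀ y → parDᵖ prog y ≡ par y
    parents-prog y with lookup I y in y∈I | scheduled-once y
    ... | true  | once = trans (parents y) (trans (parentsAlong-absent par order y (+-cancelʳ-≡ 1 _ 0 once))
                                                  (sym (IsOpenDAG.inputs-root dag y (lookup⇒[]= y I y∈I))))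
    ... | false | once = trans (parents y) (parentsAlong-once par order y (trans (sym (+-identityʳ _)) once))

  DG-correct : IsNetwork I (DG par I O) × (∀ y → parD (DG par I O) y ≡ par y)
  DG-correct =
    (λ x → trans (cong (_+ inputCount I x) (trans (boxCount-≈-normal prog (out ∘ˢ proj₁ outputs) DG≈ x) (counts x))) (scheduled-once x)) ,
    (λ y → trans (parD-≈-normal prog (out ∘ˢ proj₁ outputs) DG≈ y) (parents-prog y))

proposition5p4 : ∀ {n} (I O : Subset n) →
    ((par : Fin n → Subset n) → IsOpenDAG par I →
       IsNetwork I (DG par I O) × (∀ y → parD (DG par I O) y ≡ par y))
  × ((D : Tm (elems I) (elems O)) → IsNetwork I D →
       IsOpenDAG (parD D) I × DG (parD D) I O ≈ D)
  × ((D D' : Tm (elems I) (elems O)) → IsNetwork I D → D ≈ D' →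
       IsNetwork I D' × (∀ y → parD D y ≡ parD D' y))
proposition5p4 I O =
    (λ par dag → DG-correct par I O dag)
  , (λ D net → let dag = network⇒openDAG D net
                   (DG-net , DG-parents) = DG-correct (parD D) I O dag
               in dag , network-unique (DG (parD D) I O) D DG-net net DG-parents)
  , (λ D D′ net e → IsNetwork-resp-≈ e net , parD-resp-≈ e)
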